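{- Let $p<q<r$ be odd primes with $r>(p-1)(q-1)$. Then $\Psi_{pqr}(x)$ is flat.
   Context: $\Psi_n(x)=(x^n-1)/\Phi_n(x)\in\mathbb Z[x]$, where $\Phi_n$ is the $n$-th cyclotomic polynomial. A polynomial in $\mathbb Z[x]$ is flat if the maximum absolute value of its coefficients equals $1$. -}

module Defs where

open import Data.Nat as ℕ using (ℕ; zero; suc; _≤ᵇ_)
open import Data.Nat.Divisibility using (_∣?_)
open import Data.Integer as ℤ using (ℤ; +_; -[1+_]; ∣_∣)
open import Data.List using (List; []; _∷_; map; foldr; reverse; length; filter; upTo; replicate; _++_)
open import Data.List.Relation.Unary.All using (All)
open import Data.List.Relation.Unary.Any using (Any)
open import Data.Bool using (true; false; if_then_else_)
open import Relation.Binary.PropositionalEquality using (_≡_)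
open import Data.Product using (_×_)

-- Polynomials in ℤ[x] as coefficient lists, lowest degree first:
-- a₀ ∷ a₁ ∷ … represents a₀ + a₁ x + …  (trailing zeros allowed).
Poly : Set
Poly = List ℤ

infixl 6 _+ᴾ_
infixl 7 _*ᴾ_

_+ᴾ_ : Poly → Poly → Poly
[]       +ᴾ q        = q
(a ∷ p)  +ᴾ []       = a ∷ p
(a ∷ p)  +ᴾ (b ∷ q)  = (a ℤ.+ b) ∷ (p +ᴾ q)

_*ᴾ_ : Poly → Poly → Poly
[]      *ᴾ q = []
(a ∷ p) *ᴾ q = map (a ℤ.*_) q +ᴾ (+ 0 ∷ (p *ᴾ q))

prodᴾ : List Poly → Poly
prodᴾ = foldr _*ᴾ_ (+ 1 ∷ [])

xⁿ-1 : ℕ → Poly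
xⁿ-1 n = (-[1+ 0 ] ∷ []) +ᴾ (replicate n (+ 0) ++ (+ 1 ∷ []))

dropZeros : List ℤ → List ℤ
dropZeros []            = []
dropZeros (+ zero ∷ xs) = dropZeros xs
dropZeros (c ∷ xs)      = c ∷ xs

subFront : List ℤ → List ℤ → List ℤ
subFront xs       []       = xs
subFront []       (y ∷ ys) = ℤ.- y ∷ subFront [] ys
subFront (x ∷ xs) (y ∷ ys) = (x ℤ.- y) ∷ subFront xs ys

-- long division by a monic divisor g (both highest-first, g = 1 ∷ _),
-- returns the quotient highest-first; first argument is fuel.
divH : ℕ → List ℤ → List ℤ → List ℤ
divH zero    f g = []
divH (suc k) f [] = []
divH (suc k) f (g₀ ∷ gs) with length (g₀ ∷ gs) ≤ᵇ length f
... | false = []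
... | true with f
...   | []     = []
...   | c ∷ fs = c ∷ divH k (subFront fs (map (c ℤ.*_) gs)) (g₀ ∷ gs)

-- quotient f / g in ℤ[x] for monic g (exact whenever g divides f)
divᴾ : Poly → Poly → Poly
divᴾ f g = reverse (divH (length f) (dropZeros (reverse f)) (dropZeros (reverse g)))

properDivisors : ℕ → List ℕ
properDivisors n = filter (_∣? n) (map suc (upTo (n ℕ.∸ 1)))

-- cyclotomic polynomials via  x^n - 1 = ∏_{d ∣ n} Φ_d(x), i.e.
-- Φ_n = (x^n - 1) / ∏_{d ∣ n, d < n} Φ_d   (first argument is fuel)
cyc : ℕ → ℕ → Poly
cyc zero    n = []
cyc (suc k) n = divᴾ (xⁿ-1 n) (prodᴾ (map (cyc k) (properDivisors n)))

Φ : ℕ → Poly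
Φ n = cyc n n

Ψ : ℕ → Poly
Ψ n = divᴾ (xⁿ-1 n) (Φ n)

Flat : Poly → Set
Flat P = All (λ c → ∣ c ∣ ℕ.≤ 1) P × Any (λ c → ∣ c ∣ ≡ 1) P

-- In ℤ[x] one has Φ_p(x) Φ_pq(x) = Φ_p(x^q) and, when r is a unit
-- modulo p and modulo q, Φ_pq(x) Φ_pqr(x) = Φ_pq(xʳ); multiplying out the proper divisors of pqr
-- gives Ψ_pqr(x) = Φ_pq(x) Ψ_pq(xʳ) with Ψ_pq(x) = (x^q − 1) Φ_p(x). The divisibilities come from
-- congruences modulo x^m − 1 (as x^a ≡ x^b whenever a ≡ b mod m) together with the Bézout
-- identities r t = 1 + p k₁ and r u = 1 + q k₂.
--
-- Since deg Φ_pq = (p − 1)(q − 1) < r, every coefficient of Φ_pq(x) Ψ_pq(xʳ) is the product of a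
-- single coefficient of each factor. Ψ_pq is flat, being (x^q − 1) times a 0/1 polynomial, and so
-- is Φ_pq: below degree qK it agrees with (1 − x) Φ_q(x^p) (1 + x^q + ⋯ + x^(q(K−1))), and the
-- last two factors multiply to a 0/1 polynomial because the exponents p i + q j (i < q) are
-- distinct. The constant term of Ψ_pqr is −1.

module Submission where

open import Defs
open import Data.Nat as ℕ using (ℕ; zero; suc; _+_; _*_; _∸_; _≤_; _<_; z≤n; s≤s; _≤ᵇ_; NonZero)
import Data.Nat.Properties as ℕP
open import Data.Nat.Divisibility
  using (_∣_; _∣?_; divides; 1∣_; m∣m*n; n∣m*n; ∣-refl; _∣0; ∣m∣n⇒∣m+n; ∣m+n∣m⇒∣n; ∣⇒≤; *-cancelˡ-∣)
open import Data.Nat.Primality using (Prime; prime⇒nonTrivial; prime⇒nonZero; prime⇒irreducible; euclidsLemma)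
open import Data.Nat.Coprimality using (Coprime; coprime-Bézout; coprime-divisor; prime⇒coprime)
import Data.Nat.Coprimality as Coprimality
open import Data.Nat.GCD using (module Bézout)
open import Data.Nat.DivMod using (_/_; _%_; m≡m%n+[m/n]*n; m%n<n)
import Data.Nat.Tactic.RingSolver as ℕ-Solver
open import Data.Integer as ℤ using (ℤ; +_; -[1+_]; ∣_∣)
import Data.Integer.Properties as ℤP
open import Data.List using (List; []; _∷_; [_]; map; replicate; _++_; reverse; length; upTo)
import Data.List.Properties as List
open import Data.List.Membership.Propositional using (_∈_)
import Data.List.Membership.Propositional.Properties as ∈
open import Data.List.Relation.Unary.Any using (Any; here; there)
open import Data.List.Relation.Unary.All as All using (All; []; _∷_)
open import Data.List.Relation.Unary.AllPairs using (AllPairs; []; _∷_)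
import Data.List.Relation.Unary.AllPairs.Properties as AllPairs
open import Data.List.Relation.Unary.Linked using ([]; [-]; _∷_)
open import Data.List.Relation.Unary.Linked.Properties using (Linked⇒AllPairs)
open import Data.List.Relation.Binary.Permutation.Propositional using (_↭_; ↭-refl; ↭-sym; ↭-reflexive; prep; swap; ↭⇒↭ₛ′)
open import Data.List.Relation.Binary.Permutation.Propositional.Properties using (∈-resp-↭; map⁺)
import Data.List.Relation.Binary.Permutation.Setoid.Properties as Permutationₛ
open import Data.List.Relation.Binary.Pointwise using (Pointwise; []; _∷_)
open import Data.Bool using (true; false; T)
open import Data.Empty using (⊥; ⊥-elim)
open import Data.Sum using (_⊎_; inj₁; inj₂)
open import Data.Maybe using (Maybe; just; nothing)
open import Data.Product using (Σ; _×_; _,_; proj₁; proj₂)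
open import Relation.Binary.PropositionalEquality hiding ([_])
open import Relation.Nullary using (¬_; yes; no)
open import Relation.Binary.Bundles using (Setoid)
open import Relation.Binary.Definitions using (tri<; tri≈; tri>)
open import Relation.Binary.Structures using (IsEquivalence)
open import Algebra.Bundles using (CommutativeRing)
import Relation.Binary.Reasoning.Setoid as SetoidReasoning
import Tactic.RingSolver.Core.AlmostCommutativeRing as ACR
import Tactic.RingSolver as Solver
import Data.Integer.Tactic.RingSolver as ℤ-Solver

-- ℤ[x] as coefficient lists, up to trailing zeros

coeff : Poly → ℕ → ℤ
coeff []      n       = + 0
coeff (a ∷ p) zero    = a
coeff (a ∷ p) (suc n) = coeff p n

infix 4 _≈_
record _≈_ (p q : Poly) : Set where
  constructor mk≈
  field coeff-≡ : ∀ n → coeff p n ≡ coeff q n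
open _≈_ public

≈-refl : ∀ {p} → p ≈ p
≈-refl = mk≈ λ _ → refl

≈-sym : ∀ {p q} → p ≈ q → q ≈ p
≈-sym e = mk≈ λ n → sym (coeff-≡ e n)

≈-trans : ∀ {p q r} → p ≈ q → q ≈ r → p ≈ r
≈-trans e f = mk≈ λ n → trans (coeff-≡ e n) (coeff-≡ f n)

≈-reflexive : ∀ {p q} → p ≡ q → p ≈ q
≈-reflexive refl = ≈-refl

≈-isEquivalence : IsEquivalence _≈_
≈-isEquivalence = record { refl = ≈-refl ; sym = ≈-sym ; trans = ≈-trans }

≈-setoid : Setoid _ _
≈-setoid = record { isEquivalence = ≈-isEquivalence }

module ≈-Reasoning = SetoidReasoning ≈-setoid

∷-cong : ∀ {a b p q} → a ≡ b → p ≈ q → a ∷ p ≈ b ∷ q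
∷-cong a≡b p≈q = mk≈ λ where
  zero    → a≡b
  (suc n) → coeff-≡ p≈q n

∷-injective : ∀ {a b p q} → a ∷ p ≈ b ∷ q → a ≡ b × p ≈ q
∷-injective e = coeff-≡ e 0 , mk≈ λ n → coeff-≡ e (suc n)

[]≈∷⇒ : ∀ {b q} → [] ≈ b ∷ q → + 0 ≡ b × [] ≈ q
[]≈∷⇒ e = coeff-≡ e 0 , mk≈ λ n → coeff-≡ e (suc n)

0∷[]≈[] : + 0 ∷ [] ≈ []
0∷[]≈[] = mk≈ λ where
  zero    → refl
  (suc n) → refl

infixl 7 _·ᴾ_
infix  8 -ᴾ_
infixl 6 _-ᴾ_

_·ᴾ_ : ℤ → Poly → Poly
a ·ᴾ p = map (a ℤ.*_) p

-ᴾ_ : Poly → Poly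
-ᴾ_ = map (λ a → ℤ.- a)

_-ᴾ_ : Poly → Poly → Poly
p -ᴾ q = p +ᴾ -ᴾ q

1ᴾ : Poly
1ᴾ = + 1 ∷ []

coeff-+ᴾ : ∀ p q n → coeff (p +ᴾ q) n ≡ coeff p n ℤ.+ coeff q n
coeff-+ᴾ []      q       n       = sym (ℤP.+-identityˡ _)
coeff-+ᴾ (a ∷ p) []      n       = sym (ℤP.+-identityʳ _)
coeff-+ᴾ (a ∷ p) (b ∷ q) zero    = refl
coeff-+ᴾ (a ∷ p) (b ∷ q) (suc n) = coeff-+ᴾ p q n

coeff-·ᴾ : ∀ a p n → coeff (a ·ᴾ p) n ≡ a ℤ.* coeff p n
coeff-·ᴾ a []      n       = sym (ℤP.*-zeroʳ a)
coeff-·ᴾ a (b ∷ p) zero    = refl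
coeff-·ᴾ a (b ∷ p) (suc n) = coeff-·ᴾ a p n

coeff--ᴾ : ∀ p n → coeff (-ᴾ p) n ≡ ℤ.- coeff p n
coeff--ᴾ []      n       = refl
coeff--ᴾ (b ∷ p) zero    = refl
coeff--ᴾ (b ∷ p) (suc n) = coeff--ᴾ p n

coeff-∷*ᴾ : ∀ a p q n → coeff ((a ∷ p) *ᴾ q) n ≡ a ℤ.* coeff q n ℤ.+ coeff (+ 0 ∷ p *ᴾ q) n
coeff-∷*ᴾ a p q n = trans (coeff-+ᴾ (a ·ᴾ q) _ n) (cong (ℤ._+ _) (coeff-·ᴾ a q n))

+-cong : ∀ {p p′ q q′} → p ≈ p′ → q ≈ q′ → p +ᴾ q ≈ p′ +ᴾ q′
+-cong {p} {p′} {q} {q′} e f = mk≈ λ n → begin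
  coeff (p +ᴾ q) n                ≡⟨ coeff-+ᴾ p q n ⟩
  coeff p n ℤ.+ coeff q n         ≡⟨ cong₂ ℤ._+_ (coeff-≡ e n) (coeff-≡ f n) ⟩
  coeff p′ n ℤ.+ coeff q′ n       ≡⟨ coeff-+ᴾ p′ q′ n ⟨
  coeff (p′ +ᴾ q′) n              ∎
  where open ≡-Reasoning

-‿cong : ∀ {p q} → p ≈ q → -ᴾ p ≈ -ᴾ q
-‿cong {p} {q} e = mk≈ λ n →
  trans (coeff--ᴾ p n) (trans (cong (λ a → ℤ.- a) (coeff-≡ e n)) (sym (coeff--ᴾ q n)))

*-congˡ : ∀ p {q q′} → q ≈ q′ → p *ᴾ q ≈ p *ᴾ q′
*-congˡ []      e = ≈-refl
*-congˡ (a ∷ p) {q} {q′} e = mk≈ λ n → begin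
  coeff ((a ∷ p) *ᴾ q) n                            ≡⟨ coeff-∷*ᴾ a p q n ⟩
  a ℤ.* coeff q n ℤ.+ coeff (+ 0 ∷ p *ᴾ q) n        ≡⟨ cong₂ (λ u v → a ℤ.* u ℤ.+ v) (coeff-≡ e n)
                                                         (coeff-≡ (∷-cong refl (*-congˡ p e)) n) ⟩
  a ℤ.* coeff q′ n ℤ.+ coeff (+ 0 ∷ p *ᴾ q′) n      ≡⟨ coeff-∷*ᴾ a p q′ n ⟨
  coeff ((a ∷ p) *ᴾ q′) n                           ∎
  where open ≡-Reasoning

*-zeroʳ : ∀ p → p *ᴾ [] ≈ []
*-zeroʳ []      = ≈-refl
*-zeroʳ (a ∷ p) = mk≈ λ where
  zero    → refl
  (suc n) → coeff-≡ (*-zeroʳ p) n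

*-∷ʳ : ∀ p a q → p *ᴾ (a ∷ q) ≈ a ·ᴾ p +ᴾ (+ 0 ∷ p *ᴾ q)
*-∷ʳ []      a q = ≈-sym 0∷[]≈[]
*-∷ʳ (b ∷ p) a q = ∷-cong b*a≡a*b (mk≈ λ n → begin
  coeff (b ·ᴾ q +ᴾ p *ᴾ (a ∷ q)) n
    ≡⟨ coeff-+ᴾ (b ·ᴾ q) _ n ⟩
  coeff (b ·ᴾ q) n ℤ.+ coeff (p *ᴾ (a ∷ q)) n
    ≡⟨ cong (ℤ._+_ (coeff (b ·ᴾ q) n)) (trans (coeff-≡ (*-∷ʳ p a q) n) (coeff-+ᴾ (a ·ᴾ p) _ n)) ⟩
  coeff (b ·ᴾ q) n ℤ.+ (coeff (a ·ᴾ p) n ℤ.+ coeff (+ 0 ∷ p *ᴾ q) n)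
    ≡⟨ exchange (coeff (b ·ᴾ q) n) (coeff (a ·ᴾ p) n) _ ⟩
  coeff (a ·ᴾ p) n ℤ.+ (coeff (b ·ᴾ q) n ℤ.+ coeff (+ 0 ∷ p *ᴾ q) n)
    ≡⟨ cong (ℤ._+_ (coeff (a ·ᴾ p) n)) (coeff-+ᴾ (b ·ᴾ q) _ n) ⟨
  coeff (a ·ᴾ p) n ℤ.+ coeff (b ·ᴾ q +ᴾ (+ 0 ∷ p *ᴾ q)) n
    ≡⟨ coeff-+ᴾ (a ·ᴾ p) _ n ⟨
  coeff (a ·ᴾ p +ᴾ (b ·ᴾ q +ᴾ (+ 0 ∷ p *ᴾ q))) n ∎)
  where
  open ≡-Reasoning
  b*a≡a*b : b ℤ.* a ℤ.+ + 0 ≡ a ℤ.* b ℤ.+ + 0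
  b*a≡a*b = cong (ℤ._+ + 0) (ℤP.*-comm b a)
  exchange : ∀ x y z → x ℤ.+ (y ℤ.+ z) ≡ y ℤ.+ (x ℤ.+ z)
  exchange = ℤ-Solver.solve-∀

*-comm : ∀ p q → p *ᴾ q ≈ q *ᴾ p
*-comm []      q = ≈-sym (*-zeroʳ q)
*-comm (a ∷ p) q = ≈-trans (+-cong ≈-refl (∷-cong refl (*-comm p q))) (≈-sym (*-∷ʳ q a p))

*-congʳ : ∀ {p p′} q → p ≈ p′ → p *ᴾ q ≈ p′ *ᴾ q
*-congʳ {p} {p′} q e = ≈-trans (*-comm p q) (≈-trans (*-congˡ q e) (*-comm q p′))

*-cong : ∀ {p p′ q q′} → p ≈ p′ → q ≈ q′ → p *ᴾ q ≈ p′ *ᴾ q′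
*-cong {p′ = p′} {q} e f = ≈-trans (*-congʳ q e) (*-congˡ p′ f)

+-assoc : ∀ p q r → (p +ᴾ q) +ᴾ r ≈ p +ᴾ (q +ᴾ r)
+-assoc p q r = mk≈ λ n → begin
  coeff ((p +ᴾ q) +ᴾ r) n                        ≡⟨ coeff-+ᴾ (p +ᴾ q) r n ⟩
  coeff (p +ᴾ q) n ℤ.+ coeff r n                 ≡⟨ cong (ℤ._+ coeff r n) (coeff-+ᴾ p q n) ⟩
  coeff p n ℤ.+ coeff q n ℤ.+ coeff r n          ≡⟨ ℤP.+-assoc (coeff p n) _ _ ⟩
  coeff p n ℤ.+ (coeff q n ℤ.+ coeff r n)        ≡⟨ cong (ℤ._+_ (coeff p n)) (coeff-+ᴾ q r n) ⟨
  coeff p n ℤ.+ coeff (q +ᴾ r) n                 ≡⟨ coeff-+ᴾ p (q +ᴾ r) n ⟨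
  coeff (p +ᴾ (q +ᴾ r)) n                        ∎
  where open ≡-Reasoning

+-comm : ∀ p q → p +ᴾ q ≈ q +ᴾ p
+-comm p q = mk≈ λ n →
  trans (coeff-+ᴾ p q n) (trans (ℤP.+-comm (coeff p n) _) (sym (coeff-+ᴾ q p n)))

+-identityʳ : ∀ p → p +ᴾ [] ≈ p
+-identityʳ p = mk≈ λ n → trans (coeff-+ᴾ p [] n) (ℤP.+-identityʳ (coeff p n))

-‿inverseˡ : ∀ p → -ᴾ p +ᴾ p ≈ []
-‿inverseˡ p = mk≈ λ n → begin
  coeff (-ᴾ p +ᴾ p) n                  ≡⟨ coeff-+ᴾ (-ᴾ p) p n ⟩
  coeff (-ᴾ p) n ℤ.+ coeff p n         ≡⟨ cong (ℤ._+ coeff p n) (coeff--ᴾ p n) ⟩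
  ℤ.- coeff p n ℤ.+ coeff p n          ≡⟨ ℤP.+-inverseˡ (coeff p n) ⟩
  + 0                                  ∎
  where open ≡-Reasoning

-‿inverseʳ : ∀ p → p +ᴾ -ᴾ p ≈ []
-‿inverseʳ p = ≈-trans (+-comm p (-ᴾ p)) (-‿inverseˡ p)

*-distribˡ-+ : ∀ p q r → p *ᴾ (q +ᴾ r) ≈ p *ᴾ q +ᴾ p *ᴾ r
*-distribˡ-+ []      q r = ≈-refl
*-distribˡ-+ (a ∷ p) q r = mk≈ λ n → begin
  coeff ((a ∷ p) *ᴾ (q +ᴾ r)) n
    ≡⟨ coeff-∷*ᴾ a p (q +ᴾ r) n ⟩
  a ℤ.* coeff (q +ᴾ r) n ℤ.+ coeff (+ 0 ∷ p *ᴾ (q +ᴾ r)) n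
    ≡⟨ cong₂ (λ u v → a ℤ.* u ℤ.+ v) (coeff-+ᴾ q r n) (tail n) ⟩
  a ℤ.* (coeff q n ℤ.+ coeff r n) ℤ.+ (coeff (+ 0 ∷ p *ᴾ q) n ℤ.+ coeff (+ 0 ∷ p *ᴾ r) n)
    ≡⟨ regroup a (coeff q n) (coeff r n) _ _ ⟩
  (a ℤ.* coeff q n ℤ.+ coeff (+ 0 ∷ p *ᴾ q) n) ℤ.+ (a ℤ.* coeff r n ℤ.+ coeff (+ 0 ∷ p *ᴾ r) n)
    ≡⟨ cong₂ ℤ._+_ (coeff-∷*ᴾ a p q n) (coeff-∷*ᴾ a p r n) ⟨
  coeff ((a ∷ p) *ᴾ q) n ℤ.+ coeff ((a ∷ p) *ᴾ r) n
    ≡⟨ coeff-+ᴾ ((a ∷ p) *ᴾ q) _ n ⟨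
  coeff ((a ∷ p) *ᴾ q +ᴾ (a ∷ p) *ᴾ r) n ∎
  where
  open ≡-Reasoning
  regroup : ∀ a x y u v → a ℤ.* (x ℤ.+ y) ℤ.+ (u ℤ.+ v) ≡ (a ℤ.* x ℤ.+ u) ℤ.+ (a ℤ.* y ℤ.+ v)
  regroup = ℤ-Solver.solve-∀
  tail : ∀ n → coeff (+ 0 ∷ p *ᴾ (q +ᴾ r)) n ≡ coeff (+ 0 ∷ p *ᴾ q) n ℤ.+ coeff (+ 0 ∷ p *ᴾ r) n
  tail zero    = refl
  tail (suc n) = trans (coeff-≡ (*-distribˡ-+ p q r) n) (coeff-+ᴾ (p *ᴾ q) _ n)

*-distribʳ-+ : ∀ r p q → (p +ᴾ q) *ᴾ r ≈ p *ᴾ r +ᴾ q *ᴾ r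
*-distribʳ-+ r p q =
  ≈-trans (*-comm (p +ᴾ q) r) (≈-trans (*-distribˡ-+ r p q) (+-cong (*-comm r p) (*-comm r q)))

·ᴾ-*ᴾ : ∀ a p q → a ·ᴾ p *ᴾ q ≈ a ·ᴾ (p *ᴾ q)
·ᴾ-*ᴾ a []      q = ≈-refl
·ᴾ-*ᴾ a (b ∷ p) q = mk≈ λ n → begin
  coeff ((a ℤ.* b ∷ a ·ᴾ p) *ᴾ q) n
    ≡⟨ coeff-∷*ᴾ (a ℤ.* b) (a ·ᴾ p) q n ⟩
  a ℤ.* b ℤ.* coeff q n ℤ.+ coeff (+ 0 ∷ a ·ᴾ p *ᴾ q) n
    ≡⟨ cong (ℤ._+_ (a ℤ.* b ℤ.* coeff q n)) (tail n) ⟩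
  a ℤ.* b ℤ.* coeff q n ℤ.+ a ℤ.* coeff (+ 0 ∷ p *ᴾ q) n
    ≡⟨ factor a b (coeff q n) _ ⟩
  a ℤ.* (b ℤ.* coeff q n ℤ.+ coeff (+ 0 ∷ p *ᴾ q) n)
    ≡⟨ cong (a ℤ.*_) (coeff-∷*ᴾ b p q n) ⟨
  a ℤ.* coeff ((b ∷ p) *ᴾ q) n
    ≡⟨ coeff-·ᴾ a ((b ∷ p) *ᴾ q) n ⟨
  coeff (a ·ᴾ ((b ∷ p) *ᴾ q)) n ∎
  where
  open ≡-Reasoning
  factor : ∀ a b x y → a ℤ.* b ℤ.* x ℤ.+ a ℤ.* y ≡ a ℤ.* (b ℤ.* x ℤ.+ y)
  factor = ℤ-Solver.solve-∀
  tail : ∀ n → coeff (+ 0 ∷ a ·ᴾ p *ᴾ q) n ≡ a ℤ.* coeff (+ 0 ∷ p *ᴾ q) n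
  tail zero    = sym (ℤP.*-zeroʳ a)
  tail (suc n) = trans (coeff-≡ (·ᴾ-*ᴾ a p q) n) (coeff-·ᴾ a (p *ᴾ q) n)

0∷-*ᴾ : ∀ p q → (+ 0 ∷ p) *ᴾ q ≈ + 0 ∷ p *ᴾ q
0∷-*ᴾ p q = mk≈ λ n → trans (coeff-∷*ᴾ (+ 0) p q n) (ℤP.+-identityˡ _)

*-assoc : ∀ p q r → (p *ᴾ q) *ᴾ r ≈ p *ᴾ (q *ᴾ r)
*-assoc []      q r = ≈-refl
*-assoc (a ∷ p) q r = begin
  (a ·ᴾ q +ᴾ (+ 0 ∷ p *ᴾ q)) *ᴾ r          ≈⟨ *-distribʳ-+ r (a ·ᴾ q) _ ⟩
  a ·ᴾ q *ᴾ r +ᴾ (+ 0 ∷ p *ᴾ q) *ᴾ r       ≈⟨ +-cong (·ᴾ-*ᴾ a q r) (0∷-*ᴾ (p *ᴾ q) r) ⟩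
  a ·ᴾ (q *ᴾ r) +ᴾ (+ 0 ∷ p *ᴾ q *ᴾ r)     ≈⟨ +-cong ≈-refl (∷-cong refl (*-assoc p q r)) ⟩
  a ·ᴾ (q *ᴾ r) +ᴾ (+ 0 ∷ p *ᴾ (q *ᴾ r))   ∎
  where open ≈-Reasoning

*-identityˡ : ∀ p → 1ᴾ *ᴾ p ≈ p
*-identityˡ p = mk≈ λ n → begin
  coeff (1ᴾ *ᴾ p) n                           ≡⟨ coeff-∷*ᴾ (+ 1) [] p n ⟩
  + 1 ℤ.* coeff p n ℤ.+ coeff (+ 0 ∷ []) n    ≡⟨ cong₂ ℤ._+_ (ℤP.*-identityˡ (coeff p n)) (coeff-≡ 0∷[]≈[] n) ⟩
  coeff p n ℤ.+ + 0                           ≡⟨ ℤP.+-identityʳ (coeff p n) ⟩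
  coeff p n                                   ∎
  where open ≡-Reasoning

*-identityʳ : ∀ p → p *ᴾ 1ᴾ ≈ p
*-identityʳ p = ≈-trans (*-comm p 1ᴾ) (*-identityˡ p)

coeff-*ᴾ-0 : ∀ p q → coeff (p *ᴾ q) 0 ≡ coeff p 0 ℤ.* coeff q 0
coeff-*ᴾ-0 []      q = refl
coeff-*ᴾ-0 (a ∷ p) q = trans (coeff-∷*ᴾ a p q 0) (ℤP.+-identityʳ _)

polyCommutativeRing : CommutativeRing _ _
polyCommutativeRing = record
  { Carrier = Poly ; _≈_ = _≈_ ; _+_ = _+ᴾ_ ; _*_ = _*ᴾ_ ; -_ = -ᴾ_ ; 0# = [] ; 1# = 1ᴾ
  ; isCommutativeRing = record
    { isRing = record
      { +-isAbelianGroup = record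
        { isGroup = record
          { isMonoid = record
            { isSemigroup = record
              { isMagma = record { isEquivalence = ≈-isEquivalence ; ∙-cong = +-cong }
              ; assoc = +-assoc }
            ; identity = (λ _ → ≈-refl) , +-identityʳ }
          ; inverse = -‿inverseˡ , -‿inverseʳ
          ; ⁻¹-cong = -‿cong }
        ; comm = +-comm }
      ; *-cong = *-cong
      ; *-assoc = *-assoc
      ; *-identity = *-identityˡ , *-identityʳ
      ; distrib = *-distribˡ-+ , *-distribʳ-+ }
    ; *-comm = *-comm } }

-- The ring solver treats integer polynomials such as 1ᴾ as constants; recognising
-- the zero constants lets it cancel them.
≈[]? : ∀ p → Maybe ([] ≈ p)
≈[]? []          = just ≈-refl
≈[]? (+ 0 ∷ p)   with ≈[]? p
... | just e  = just (≈-trans (≈-sym 0∷[]≈[]) (∷-cong refl e))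
... | nothing = nothing
≈[]? (+ suc _ ∷ p) = nothing
≈[]? (-[1+ _ ] ∷ p) = nothing

polyRing : ACR.AlmostCommutativeRing _ _
polyRing = ACR.fromCommutativeRing polyCommutativeRing ≈[]?

X^ : ℕ → Poly
X^ n = replicate n (+ 0) ++ 1ᴾ

X : Poly
X = X^ 1

X^-suc-* : ∀ n p → X^ (suc n) *ᴾ p ≈ + 0 ∷ X^ n *ᴾ p
X^-suc-* n = 0∷-*ᴾ (X^ n)

X^-suc : ∀ n → X^ (suc n) ≈ X *ᴾ X^ n
X^-suc n = ≈-sym (≈-trans (0∷-*ᴾ 1ᴾ (X^ n)) (∷-cong refl (*-identityˡ (X^ n))))

X^-+ : ∀ a b → X^ (a + b) ≈ X^ a *ᴾ X^ b
X^-+ zero    b = ≈-sym (*-identityˡ (X^ b))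
X^-+ (suc a) b = ≈-trans (∷-cong refl (X^-+ a b)) (≈-sym (X^-suc-* a (X^ b)))

coeff-X^*-< : ∀ m p n → n < m → coeff (X^ m *ᴾ p) n ≡ + 0
coeff-X^*-< (suc m) p zero    _         = coeff-≡ (X^-suc-* m p) zero
coeff-X^*-< (suc m) p (suc n) (s≤s n<m) = trans (coeff-≡ (X^-suc-* m p) (suc n)) (coeff-X^*-< m p n n<m)

coeff-X^*-+ : ∀ m p n → coeff (X^ m *ᴾ p) (m + n) ≡ coeff p n
coeff-X^*-+ zero    p n = coeff-≡ (*-identityˡ p) n
coeff-X^*-+ (suc m) p n = trans (coeff-≡ (X^-suc-* m p) (suc (m + n))) (coeff-X^*-+ m p n)

shift : ℕ → (ℕ → ℤ) → ℕ → ℤ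
shift m f n with m ℕ.≤? n
... | yes _ = f (n ∸ m)
... | no  _ = + 0

coeff-X^* : ∀ m p n → coeff (X^ m *ᴾ p) n ≡ shift m (coeff p) n
coeff-X^* m p n with m ℕ.≤? n
... | no  m≰n = coeff-X^*-< m p n (ℕP.≰⇒> m≰n)
... | yes m≤n = trans (cong (coeff (X^ m *ᴾ p)) (sym (ℕP.m+[n∸m]≡n m≤n))) (coeff-X^*-+ m p (n ∸ m))

xⁿ-1≈ : ∀ n → xⁿ-1 n ≈ X^ n -ᴾ 1ᴾ
xⁿ-1≈ n = +-comm (-ᴾ 1ᴾ) (X^ n)

xⁿ-1-cong : ∀ {m n} → m ≡ n → xⁿ-1 m ≈ xⁿ-1 n
xⁿ-1-cong refl = ≈-refl

coeff-xⁿ-1* : ∀ m p n → coeff (xⁿ-1 m *ᴾ p) n ≡ shift m (coeff p) n ℤ.- coeff p n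
coeff-xⁿ-1* m p n = begin
  coeff (xⁿ-1 m *ᴾ p) n                      ≡⟨ coeff-≡ (*-congʳ p (xⁿ-1≈ m)) n ⟩
  coeff ((X^ m -ᴾ 1ᴾ) *ᴾ p) n                ≡⟨ coeff-≡ (expand (X^ m) p) n ⟩
  coeff (X^ m *ᴾ p -ᴾ p) n                   ≡⟨ coeff-+ᴾ (X^ m *ᴾ p) (-ᴾ p) n ⟩
  coeff (X^ m *ᴾ p) n ℤ.+ coeff (-ᴾ p) n     ≡⟨ cong₂ ℤ._+_ (coeff-X^* m p n) (coeff--ᴾ p n) ⟩
  shift m (coeff p) n ℤ.- coeff p n          ∎
  where
  open ≡-Reasoning
  expand : ∀ x p → (x -ᴾ 1ᴾ) *ᴾ p ≈ x *ᴾ p -ᴾ p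
  expand = Solver.solve-∀ polyRing

geom : ℕ → Poly
geom n = replicate n (+ 1)

coeff-xⁿ-1-0 : ∀ {n} → 0 < n → coeff (xⁿ-1 n) 0 ≡ -[1+ 0 ]
coeff-xⁿ-1-0 {suc n} _ = refl

coeff-geom-0 : ∀ {n} → 0 < n → coeff (geom n) 0 ≡ + 1
coeff-geom-0 {suc n} _ = refl

geom-suc : ∀ n → geom (suc n) ≈ 1ᴾ +ᴾ X *ᴾ geom n
geom-suc n = mk≈ λ where
  zero    → sym (trans (coeff-+ᴾ 1ᴾ (X *ᴾ geom n) 0) (cong (ℤ._+_ (+ 1)) (coeff-X^*-< 1 (geom n) 0 (s≤s z≤n))))
  (suc k) → sym (trans (coeff-+ᴾ 1ᴾ (X *ᴾ geom n) (suc k)) (trans (ℤP.+-identityˡ _) (coeff-X^*-+ 1 (geom n) k)))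

x-1*geom : ∀ n → xⁿ-1 1 *ᴾ geom n ≈ xⁿ-1 n
x-1*geom zero    = ≈-trans (*-zeroʳ (xⁿ-1 1)) (≈-sym 0∷[]≈[])
x-1*geom (suc n) = begin
  xⁿ-1 1 *ᴾ geom (suc n)                 ≈⟨ *-cong (xⁿ-1≈ 1) (geom-suc n) ⟩
  (X -ᴾ 1ᴾ) *ᴾ (1ᴾ +ᴾ X *ᴾ geom n)       ≈⟨ telescope X (geom n) ⟩
  X *ᴾ ((X -ᴾ 1ᴾ) *ᴾ geom n) +ᴾ X -ᴾ 1ᴾ  ≈⟨ +-cong (+-cong (*-congˡ X step) ≈-refl) ≈-refl ⟩
  X *ᴾ (X^ n -ᴾ 1ᴾ) +ᴾ X -ᴾ 1ᴾ           ≈⟨ collapse X (X^ n) ⟩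
  X *ᴾ X^ n -ᴾ 1ᴾ                        ≈⟨ ≈-sym (≈-trans (xⁿ-1≈ (suc n)) (+-cong (X^-suc n) ≈-refl)) ⟩
  xⁿ-1 (suc n)                           ∎
  where
  open ≈-Reasoning
  step : (X -ᴾ 1ᴾ) *ᴾ geom n ≈ X^ n -ᴾ 1ᴾ
  step = ≈-trans (*-congʳ (geom n) (≈-sym (xⁿ-1≈ 1))) (≈-trans (x-1*geom n) (xⁿ-1≈ n))
  telescope : ∀ x s → (x -ᴾ 1ᴾ) *ᴾ (1ᴾ +ᴾ x *ᴾ s) ≈ x *ᴾ ((x -ᴾ 1ᴾ) *ᴾ s) +ᴾ x -ᴾ 1ᴾ
  telescope = Solver.solve-∀ polyRing
  collapse : ∀ x y → x *ᴾ (y -ᴾ 1ᴾ) +ᴾ x -ᴾ 1ᴾ ≈ x *ᴾ y -ᴾ 1ᴾ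
  collapse = Solver.solve-∀ polyRing

-- Dilation: dilate r p = p(xʳ)

dilate : ℕ → Poly → Poly
dilate r []      = []
dilate r (a ∷ p) = (a ∷ []) +ᴾ X^ r *ᴾ dilate r p

const-*ᴾ : ∀ a p → (a ∷ []) *ᴾ p ≈ a ·ᴾ p
const-*ᴾ a p = ≈-trans (+-cong ≈-refl 0∷[]≈[]) (+-identityʳ (a ·ᴾ p))

dilate-≈[] : ∀ r {p} → [] ≈ p → dilate r p ≈ []
dilate-≈[] r {[]}    e = ≈-refl
dilate-≈[] r {b ∷ p} e with []≈∷⇒ e
... | refl , e′ = ≈-trans (+-cong 0∷[]≈[] (*-congˡ (X^ r) (dilate-≈[] r e′))) (*-zeroʳ (X^ r))

dilate-cong : ∀ r {p q} → p ≈ q → dilate r p ≈ dilate r q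
dilate-cong r {[]}    {q}     e = ≈-sym (dilate-≈[] r e)
dilate-cong r {a ∷ p} {[]}    e = dilate-≈[] r (≈-sym e)
dilate-cong r {a ∷ p} {b ∷ q} e with ∷-injective e
... | refl , e′ = +-cong ≈-refl (*-congˡ (X^ r) (dilate-cong r e′))

dilate-+ : ∀ r p q → dilate r (p +ᴾ q) ≈ dilate r p +ᴾ dilate r q
dilate-+ r []      q       = ≈-refl
dilate-+ r (a ∷ p) []      = ≈-sym (+-identityʳ _)
dilate-+ r (a ∷ p) (b ∷ q) =
  ≈-trans (+-cong ≈-refl (*-congˡ (X^ r) (dilate-+ r p q)))
          (regroup (a ∷ []) (b ∷ []) (X^ r) (dilate r p) (dilate r q))
  where
  regroup : ∀ a b x p q → (a +ᴾ b) +ᴾ x *ᴾ (p +ᴾ q) ≈ (a +ᴾ x *ᴾ p) +ᴾ (b +ᴾ x *ᴾ q)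
  regroup = Solver.solve-∀ polyRing

dilate-·ᴾ : ∀ r c p → dilate r (c ·ᴾ p) ≈ (c ∷ []) *ᴾ dilate r p
dilate-·ᴾ r c []      = ≈-sym (*-zeroʳ (c ∷ []))
dilate-·ᴾ r c (a ∷ p) = begin
  (c ℤ.* a ∷ []) +ᴾ X^ r *ᴾ dilate r (c ·ᴾ p)           ≈⟨ +-cong (≈-sym (const-*ᴾ c (a ∷ []))) (*-congˡ (X^ r) (dilate-·ᴾ r c p)) ⟩
  (c ∷ []) *ᴾ (a ∷ []) +ᴾ X^ r *ᴾ ((c ∷ []) *ᴾ dilate r p) ≈⟨ factor (c ∷ []) (a ∷ []) (X^ r) (dilate r p) ⟩
  (c ∷ []) *ᴾ ((a ∷ []) +ᴾ X^ r *ᴾ dilate r p)           ∎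
  where
  open ≈-Reasoning
  factor : ∀ c a x p → c *ᴾ a +ᴾ x *ᴾ (c *ᴾ p) ≈ c *ᴾ (a +ᴾ x *ᴾ p)
  factor = Solver.solve-∀ polyRing

dilate-* : ∀ r p q → dilate r (p *ᴾ q) ≈ dilate r p *ᴾ dilate r q
dilate-* r []      q = ≈-refl
dilate-* r (a ∷ p) q = begin
  dilate r (a ·ᴾ q +ᴾ (+ 0 ∷ p *ᴾ q))
    ≈⟨ dilate-+ r (a ·ᴾ q) _ ⟩
  dilate r (a ·ᴾ q) +ᴾ ((+ 0 ∷ []) +ᴾ X^ r *ᴾ dilate r (p *ᴾ q))
    ≈⟨ +-cong (dilate-·ᴾ r a q) (+-cong 0∷[]≈[] (*-congˡ (X^ r) (dilate-* r p q))) ⟩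
  (a ∷ []) *ᴾ dilate r q +ᴾ X^ r *ᴾ (dilate r p *ᴾ dilate r q)
    ≈⟨ factor (a ∷ []) (X^ r) (dilate r p) (dilate r q) ⟩
  ((a ∷ []) +ᴾ X^ r *ᴾ dilate r p) *ᴾ dilate r q ∎
  where
  open ≈-Reasoning
  factor : ∀ a x p q → a *ᴾ q +ᴾ x *ᴾ (p *ᴾ q) ≈ (a +ᴾ x *ᴾ p) *ᴾ q
  factor = Solver.solve-∀ polyRing

dilate--ᴾ : ∀ r p → dilate r (-ᴾ p) ≈ -ᴾ dilate r p
dilate--ᴾ r []      = ≈-refl
dilate--ᴾ r (a ∷ p) = ≈-trans (+-cong ≈-refl (*-congˡ (X^ r) (dilate--ᴾ r p))) (negate (a ∷ []) (X^ r) (dilate r p))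
  where
  negate : ∀ a x p → -ᴾ a +ᴾ x *ᴾ -ᴾ p ≈ -ᴾ (a +ᴾ x *ᴾ p)
  negate = Solver.solve-∀ polyRing

dilate-1ᴾ : ∀ r → dilate r 1ᴾ ≈ 1ᴾ
dilate-1ᴾ r = +-cong ≈-refl (*-zeroʳ (X^ r))

dilate-X^ : ∀ r n → dilate r (X^ n) ≈ X^ (r * n)
dilate-X^ r zero    = ≈-trans (dilate-1ᴾ r) (≈-reflexive (cong X^ (sym (ℕP.*-zeroʳ r))))
dilate-X^ r (suc n) = begin
  (+ 0 ∷ []) +ᴾ X^ r *ᴾ dilate r (X^ n)  ≈⟨ +-cong 0∷[]≈[] (*-congˡ (X^ r) (dilate-X^ r n)) ⟩
  X^ r *ᴾ X^ (r * n)                     ≈⟨ X^-+ r (r * n) ⟨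
  X^ (r + r * n)                         ≡⟨ cong X^ (ℕP.*-suc r n) ⟨
  X^ (r * suc n)                         ∎
  where open ≈-Reasoning

dilate-xⁿ-1 : ∀ r n → dilate r (xⁿ-1 n) ≈ xⁿ-1 (r * n)
dilate-xⁿ-1 r n = begin
  dilate r (-ᴾ 1ᴾ +ᴾ X^ n)           ≈⟨ dilate-+ r (-ᴾ 1ᴾ) (X^ n) ⟩
  dilate r (-ᴾ 1ᴾ) +ᴾ dilate r (X^ n) ≈⟨ +-cong (≈-trans (dilate--ᴾ r 1ᴾ) (-‿cong (dilate-1ᴾ r))) (dilate-X^ r n) ⟩
  -ᴾ 1ᴾ +ᴾ X^ (r * n)                ∎
  where open ≈-Reasoning

xⁿ-1*dilate-geom : ∀ r n → xⁿ-1 r *ᴾ dilate r (geom n) ≈ xⁿ-1 (r * n)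
xⁿ-1*dilate-geom r n = begin
  xⁿ-1 r *ᴾ dilate r (geom n)                ≈⟨ *-congʳ (dilate r (geom n)) (xⁿ-1-cong (ℕP.*-identityʳ r)) ⟨
  xⁿ-1 (r * 1) *ᴾ dilate r (geom n)          ≈⟨ *-congʳ (dilate r (geom n)) (dilate-xⁿ-1 r 1) ⟨
  dilate r (xⁿ-1 1) *ᴾ dilate r (geom n)     ≈⟨ dilate-* r (xⁿ-1 1) (geom n) ⟨
  dilate r (xⁿ-1 1 *ᴾ geom n)                ≈⟨ dilate-cong r (x-1*geom n) ⟩
  dilate r (xⁿ-1 n)                          ≈⟨ dilate-xⁿ-1 r n ⟩
  xⁿ-1 (r * n)                               ∎
  where open ≈-Reasoning

dilate-const : ∀ r a → dilate r (a ∷ []) ≈ a ∷ []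
dilate-const r a = +-cong ≈-refl (*-zeroʳ (X^ r))

dilate-dilate : ∀ r s p → dilate r (dilate s p) ≈ dilate (s * r) p
dilate-dilate r s []      = ≈-refl
dilate-dilate r s (a ∷ p) = begin
  dilate r ((a ∷ []) +ᴾ X^ s *ᴾ dilate s p)
    ≈⟨ dilate-+ r (a ∷ []) (X^ s *ᴾ dilate s p) ⟩
  dilate r (a ∷ []) +ᴾ dilate r (X^ s *ᴾ dilate s p)
    ≈⟨ +-cong (dilate-const r a) (dilate-* r (X^ s) (dilate s p)) ⟩
  (a ∷ []) +ᴾ dilate r (X^ s) *ᴾ dilate r (dilate s p)
    ≈⟨ +-cong ≈-refl (*-cong (dilate-X^ r s) (dilate-dilate r s p)) ⟩
  (a ∷ []) +ᴾ X^ (r * s) *ᴾ dilate (s * r) p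
    ≡⟨ cong (λ k → (a ∷ []) +ᴾ X^ k *ᴾ dilate (s * r) p) (ℕP.*-comm r s) ⟩
  (a ∷ []) +ᴾ X^ (s * r) *ᴾ dilate (s * r) p ∎
  where open ≈-Reasoning

-- Divisibility and congruences in ℤ[x]

infix 4 _∣ᴾ_ _≈_[mod_]

record _∣ᴾ_ (d p : Poly) : Set where
  constructor divides
  field
    quotient : Poly
    equality : p ≈ quotient *ᴾ d
open _∣ᴾ_ public

∣ᴾ-resp-≈ : ∀ {d p q} → p ≈ q → d ∣ᴾ p → d ∣ᴾ q
∣ᴾ-resp-≈ p≈q (divides c p≈cd) = divides c (≈-trans (≈-sym p≈q) p≈cd)

∣ᴾ-+ : ∀ {d p q} → d ∣ᴾ p → d ∣ᴾ q → d ∣ᴾ p +ᴾ q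
∣ᴾ-+ {d} (divides a e) (divides b f) =
  divides (a +ᴾ b) (≈-trans (+-cong e f) (≈-sym (*-distribʳ-+ d a b)))

∣ᴾ-neg : ∀ {d p} → d ∣ᴾ p → d ∣ᴾ -ᴾ p
∣ᴾ-neg {d} (divides a e) = divides (-ᴾ a) (≈-trans (-‿cong e) (negate a d))
  where
  negate : ∀ a d → -ᴾ (a *ᴾ d) ≈ -ᴾ a *ᴾ d
  negate = Solver.solve-∀ polyRing

∣ᴾ-*ˡ : ∀ {d p} q → d ∣ᴾ p → d ∣ᴾ q *ᴾ p
∣ᴾ-*ˡ {d} q (divides a e) = divides (q *ᴾ a) (≈-trans (*-congˡ q e) (≈-sym (*-assoc q a d)))

record _≈_[mod_] (f g d : Poly) : Set where
  constructor ≈-mod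
  field ∣-difference : d ∣ᴾ f -ᴾ g
open _≈_[mod_] public

≈⇒≈-mod : ∀ {d f g} → f ≈ g → f ≈ g [mod d ]
≈⇒≈-mod {g = g} f≈g = ≈-mod (divides [] (≈-trans (+-cong f≈g ≈-refl) (-‿inverseʳ g)))

≈-mod-sym : ∀ {d f g} → f ≈ g [mod d ] → g ≈ f [mod d ]
≈-mod-sym {f = f} {g} (≈-mod e) = ≈-mod (∣ᴾ-resp-≈ (negate f g) (∣ᴾ-neg e))
  where
  negate : ∀ f g → -ᴾ (f -ᴾ g) ≈ g -ᴾ f
  negate = Solver.solve-∀ polyRing

≈-mod-trans : ∀ {d f g h} → f ≈ g [mod d ] → g ≈ h [mod d ] → f ≈ h [mod d ]
≈-mod-trans {f = f} {g} {h} (≈-mod e) (≈-mod e′) = ≈-mod (∣ᴾ-resp-≈ (telescope f g h) (∣ᴾ-+ e e′))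
  where
  telescope : ∀ f g h → (f -ᴾ g) +ᴾ (g -ᴾ h) ≈ f -ᴾ h
  telescope = Solver.solve-∀ polyRing

≈-mod-setoid : Poly → Setoid _ _
≈-mod-setoid d = record
  { Carrier = Poly
  ; _≈_ = λ f g → f ≈ g [mod d ]
  ; isEquivalence = record { refl = ≈⇒≈-mod ≈-refl ; sym = ≈-mod-sym ; trans = ≈-mod-trans } }

module ≈-mod-Reasoning (d : Poly) = SetoidReasoning (≈-mod-setoid d)

≈-mod-*ˡ : ∀ {d f g} h → f ≈ g [mod d ] → h *ᴾ f ≈ h *ᴾ g [mod d ]
≈-mod-*ˡ {f = f} {g} h (≈-mod e) = ≈-mod (∣ᴾ-resp-≈ (*-distribˡ-- h f g) (∣ᴾ-*ˡ h e))
  where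
  *-distribˡ-- : ∀ h f g → h *ᴾ (f -ᴾ g) ≈ h *ᴾ f -ᴾ h *ᴾ g
  *-distribˡ-- = Solver.solve-∀ polyRing

≈-mod-*ʳ : ∀ {d f g} h → f ≈ g [mod d ] → f *ᴾ h ≈ g *ᴾ h [mod d ]
≈-mod-*ʳ {f = f} {g} h e =
  ≈-mod-trans (≈⇒≈-mod (*-comm f h)) (≈-mod-trans (≈-mod-*ˡ h e) (≈⇒≈-mod (*-comm h g)))

∣ᴾ⇒≈0-mod : ∀ {d p} → d ∣ᴾ p → p ≈ [] [mod d ]
∣ᴾ⇒≈0-mod {p = p} e = ≈-mod (∣ᴾ-resp-≈ (≈-sym (+-identityʳ p)) e)

≈0-mod⇒∣ᴾ : ∀ {d p} → p ≈ [] [mod d ] → d ∣ᴾ p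
≈0-mod⇒∣ᴾ {p = p} (≈-mod e) = ∣ᴾ-resp-≈ (+-identityʳ p) e

xⁿ-1-∣ : ∀ m k → xⁿ-1 m ∣ᴾ xⁿ-1 (m * k)
xⁿ-1-∣ m k = divides (dilate m (geom k)) (≈-trans (≈-sym (xⁿ-1*dilate-geom m k)) (*-comm (xⁿ-1 m) _))

xⁿ-1-mod : ∀ m {a b} k → a ≡ b + m * k → xⁿ-1 a ≈ xⁿ-1 b [mod xⁿ-1 m ]
xⁿ-1-mod m {a} {b} k refl = ≈-mod (∣ᴾ-resp-≈ (≈-sym difference) (∣ᴾ-*ˡ (X^ b) (xⁿ-1-∣ m k)))
  where
  cancel : ∀ x y → (x *ᴾ y -ᴾ 1ᴾ) -ᴾ (x -ᴾ 1ᴾ) ≈ x *ᴾ (y -ᴾ 1ᴾ)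
  cancel = Solver.solve-∀ polyRing
  difference : xⁿ-1 (b + m * k) -ᴾ xⁿ-1 b ≈ X^ b *ᴾ xⁿ-1 (m * k)
  difference = begin
    xⁿ-1 (b + m * k) -ᴾ xⁿ-1 b                ≈⟨ +-cong (≈-trans (xⁿ-1≈ _) (+-cong (X^-+ b (m * k)) ≈-refl)) (-‿cong (xⁿ-1≈ b)) ⟩
    (X^ b *ᴾ X^ (m * k) -ᴾ 1ᴾ) -ᴾ (X^ b -ᴾ 1ᴾ) ≈⟨ cancel (X^ b) (X^ (m * k)) ⟩
    X^ b *ᴾ (X^ (m * k) -ᴾ 1ᴾ)                ≈⟨ *-congˡ (X^ b) (xⁿ-1≈ (m * k)) ⟨
    X^ b *ᴾ xⁿ-1 (m * k)                      ∎
    where open ≈-Reasoning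

xⁿ-1*-≈[] : ∀ m p → 0 < m → xⁿ-1 m *ᴾ p ≈ [] → p ≈ []
xⁿ-1*-≈[] m p m>0 e = mk≈ λ n → vanish (suc n) n ℕP.≤-refl
  where
  periodic : ∀ n → shift m (coeff p) n ≡ coeff p n
  periodic n = ℤP.i-j≡0⇒i≡j _ _ (trans (sym (coeff-xⁿ-1* m p n)) (coeff-≡ e n))
  vanish : ∀ b n → n < b → coeff p n ≡ + 0
  vanish (suc b) n (s≤s n≤b) with m ℕ.≤? n | periodic n
  ... | no  _   | pₙ = sym pₙ
  ... | yes m≤n | pₙ = trans (sym pₙ) (vanish b (n ∸ m) (ℕP.≤-trans (ℕP.∸-monoʳ-< m>0 m≤n) n≤b))

xⁿ-1-cancelˡ : ∀ m {p q} → 0 < m → xⁿ-1 m *ᴾ p ≈ xⁿ-1 m *ᴾ q → p ≈ q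
xⁿ-1-cancelˡ m {p} {q} m>0 e = begin
  p                ≈⟨ restore p q ⟨
  (p -ᴾ q) +ᴾ q    ≈⟨ +-cong (xⁿ-1*-≈[] m (p -ᴾ q) m>0 difference) ≈-refl ⟩
  q                ∎
  where
  open ≈-Reasoning
  restore : ∀ p q → (p -ᴾ q) +ᴾ q ≈ p
  restore = Solver.solve-∀ polyRing
  distrib : ∀ d p q → d *ᴾ (p -ᴾ q) ≈ d *ᴾ p -ᴾ d *ᴾ q
  distrib = Solver.solve-∀ polyRing
  difference : xⁿ-1 m *ᴾ (p -ᴾ q) ≈ []
  difference = ≈-trans (distrib (xⁿ-1 m) p q) (≈-trans (+-cong e ≈-refl) (-‿inverseʳ (xⁿ-1 m *ᴾ q)))

-- Normal forms and exact division

normalForm : Poly → List ℤ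
normalForm p = dropZeros (reverse p)

consTrim : ℤ → List ℤ → List ℤ
consTrim a         (x ∷ s) = a ∷ x ∷ s
consTrim (+ zero)  []      = []
consTrim (+ suc n) []      = + suc n ∷ []
consTrim -[1+ n ]  []      = -[1+ n ] ∷ []

trim : Poly → Poly
trim []      = []
trim (a ∷ p) = consTrim a (trim p)

consTrim-≈ : ∀ a s → consTrim a s ≈ a ∷ s
consTrim-≈ a         (x ∷ s) = ≈-refl
consTrim-≈ (+ zero)  []      = ≈-sym 0∷[]≈[]
consTrim-≈ (+ suc n) []      = ≈-refl
consTrim-≈ -[1+ n ]  []      = ≈-refl

trim-≈ : ∀ p → trim p ≈ p
trim-≈ []      = ≈-refl
trim-≈ (a ∷ p) = ≈-trans (consTrim-≈ a (trim p)) (∷-cong refl (trim-≈ p))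

trim-cong : ∀ {p q} → p ≈ q → trim p ≡ trim q
trim-cong {[]}    {[]}    e = refl
trim-cong {[]}    {b ∷ q} e with []≈∷⇒ e
... | refl , e′ = cong (consTrim (+ 0)) (trim-cong {[]} {q} e′)
trim-cong {a ∷ p} {[]}    e with []≈∷⇒ (≈-sym e)
... | refl , e′ = cong (consTrim (+ 0)) (trim-cong {p} {[]} (≈-sym e′))
trim-cong {a ∷ p} {b ∷ q} e with ∷-injective e
... | refl , e′ = cong (consTrim a) (trim-cong e′)

dropZerosThen : List ℤ → List ℤ → List ℤ
dropZerosThen []      ys = dropZeros ys
dropZerosThen (x ∷ s) ys = x ∷ s ++ ys

dropZeros-++ : ∀ xs ys → dropZeros (xs ++ ys) ≡ dropZerosThen (dropZeros xs) ys
dropZeros-++ []             ys = refl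
dropZeros-++ (+ zero ∷ xs)  ys = dropZeros-++ xs ys
dropZeros-++ (+ suc n ∷ xs) ys = refl
dropZeros-++ (-[1+ n ] ∷ xs) ys = refl

dropZerosThen-reverse : ∀ a s → dropZerosThen (reverse s) [ a ] ≡ reverse (consTrim a s)
dropZerosThen-reverse (+ zero)  []      = refl
dropZerosThen-reverse (+ suc n) []      = refl
dropZerosThen-reverse -[1+ n ]  []      = refl
dropZerosThen-reverse a         (x ∷ s) = begin
  dropZerosThen (reverse (x ∷ s)) [ a ]  ≡⟨ cong (λ l → dropZerosThen l [ a ]) (List.unfold-reverse x s) ⟩
  dropZerosThen (reverse s ++ [ x ]) [ a ] ≡⟨ nonEmpty (reverse s) ⟩
  (reverse s ++ [ x ]) ++ [ a ]          ≡⟨ cong (_++ [ a ]) (List.unfold-reverse x s) ⟨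
  reverse (x ∷ s) ++ [ a ]               ≡⟨ List.unfold-reverse a (x ∷ s) ⟨
  reverse (a ∷ x ∷ s)                    ∎
  where
  open ≡-Reasoning
  nonEmpty : ∀ l → dropZerosThen (l ++ [ x ]) [ a ] ≡ (l ++ [ x ]) ++ [ a ]
  nonEmpty []      = refl
  nonEmpty (_ ∷ _) = refl

normalForm-trim : ∀ p → normalForm p ≡ reverse (trim p)
normalForm-trim []      = refl
normalForm-trim (a ∷ p) = begin
  dropZeros (reverse (a ∷ p))            ≡⟨ cong dropZeros (List.unfold-reverse a p) ⟩
  dropZeros (reverse p ++ [ a ])         ≡⟨ dropZeros-++ (reverse p) [ a ] ⟩
  dropZerosThen (normalForm p) [ a ]     ≡⟨ cong (λ l → dropZerosThen l [ a ]) (normalForm-trim p) ⟩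
  dropZerosThen (reverse (trim p)) [ a ] ≡⟨ dropZerosThen-reverse a (trim p) ⟩
  reverse (consTrim a (trim p))          ∎
  where open ≡-Reasoning

normalForm-cong : ∀ {p q} → p ≈ q → normalForm p ≡ normalForm q
normalForm-cong {p} {q} e =
  trans (normalForm-trim p) (trans (cong reverse (trim-cong e)) (sym (normalForm-trim q)))

reverse-normalForm : ∀ p → reverse (normalForm p) ≈ p
reverse-normalForm p = begin
  reverse (normalForm p)      ≡⟨ cong reverse (normalForm-trim p) ⟩
  reverse (reverse (trim p))  ≡⟨ List.reverse-involutive (trim p) ⟩
  trim p                      ≈⟨ trim-≈ p ⟩
  p                           ∎
  where open ≈-Reasoning

NonZeroHead : List ℤ → Set
NonZeroHead []      = ⊥
NonZeroHead (x ∷ _) = ¬ x ≡ + 0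

dropZeros-NonZeroHead : ∀ l → NonZeroHead l → dropZeros l ≡ l
dropZeros-NonZeroHead (+ zero ∷ s)  nz = ⊥-elim (nz refl)
dropZeros-NonZeroHead (+ suc n ∷ s) nz = refl
dropZeros-NonZeroHead (-[1+ n ] ∷ s) nz = refl

normalForm-reverse : ∀ l → NonZeroHead l → normalForm (reverse l) ≡ l
normalForm-reverse l nz = trans (cong dropZeros (List.reverse-involutive l)) (dropZeros-NonZeroHead l nz)

dropZeros-shape : ∀ l → dropZeros l ≡ [] ⊎ NonZeroHead (dropZeros l)
dropZeros-shape []             = inj₁ refl
dropZeros-shape (+ zero ∷ l)   = dropZeros-shape l
dropZeros-shape (+ suc n ∷ l)  = inj₂ (λ ())
dropZeros-shape (-[1+ n ] ∷ l) = inj₂ (λ ())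

normalForm-shape : ∀ p → normalForm p ≡ [] ⊎ NonZeroHead (normalForm p)
normalForm-shape p = dropZeros-shape (reverse p)

length-dropZeros : ∀ l → length (dropZeros l) ≤ length l
length-dropZeros []             = z≤n
length-dropZeros (+ zero ∷ l)   = ℕP.m≤n⇒m≤1+n (length-dropZeros l)
length-dropZeros (+ suc n ∷ l)  = ℕP.≤-refl
length-dropZeros (-[1+ n ] ∷ l) = ℕP.≤-refl

length-normalForm : ∀ p → length (normalForm p) ≤ length p
length-normalForm p = ℕP.≤-trans (length-dropZeros (reverse p)) (ℕP.≤-reflexive (List.length-reverse p))

-- The highest-first product, in exactly the shape that divH takes apart.
mulH : List ℤ → List ℤ → List ℤ
mulH g []      = replicate (length g ∸ 1) (+ 0)
mulH g (c ∷ h) = (c ·ᴾ g ++ replicate (length h) (+ 0)) +ᴾ (+ 0 ∷ mulH g h)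

length-+ᴾ : ∀ p q → length p ≡ length q → length (p +ᴾ q) ≡ length p
length-+ᴾ []      []      e = refl
length-+ᴾ (a ∷ p) (b ∷ q) e = cong suc (length-+ᴾ p q (ℕP.suc-injective e))

length-leading : ∀ c g t → length (c ·ᴾ g ++ replicate t (+ 0)) ≡ length g + t
length-leading c g t =
  trans (List.length-++ (c ·ᴾ g)) (cong₂ _+_ (List.length-map (c ℤ.*_) g) (List.length-replicate t))

length-mulH : ∀ x gs h → length (mulH (x ∷ gs) h) ≡ length gs + length h
length-mulH x gs []      = trans (List.length-replicate (length gs)) (sym (ℕP.+-identityʳ _))
length-mulH x gs (c ∷ h) = begin
  length ((c ·ᴾ (x ∷ gs) ++ replicate (length h) (+ 0)) +ᴾ (+ 0 ∷ mulH (x ∷ gs) h))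
    ≡⟨ length-+ᴾ (c ·ᴾ (x ∷ gs) ++ replicate (length h) (+ 0)) (+ 0 ∷ mulH (x ∷ gs) h)
                 (trans (length-leading c (x ∷ gs) (length h)) (cong suc (sym (length-mulH x gs h)))) ⟩
  length (c ·ᴾ (x ∷ gs) ++ replicate (length h) (+ 0))
    ≡⟨ length-leading c (x ∷ gs) (length h) ⟩
  suc (length gs + length h)
    ≡⟨ ℕP.+-suc (length gs) (length h) ⟨
  length gs + suc (length h) ∎
  where open ≡-Reasoning

replicate0-+ᴾ : ∀ t m → length m ≡ t → replicate t (+ 0) +ᴾ m ≡ m
replicate0-+ᴾ zero    m       e = refl
replicate0-+ᴾ (suc t) (y ∷ m) e = cong₂ _∷_ (ℤP.+-identityˡ y) (replicate0-+ᴾ t m (ℕP.suc-injective e))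

subFront-leading : ∀ u t m → length m ≡ length u + t → subFront ((u ++ replicate t (+ 0)) +ᴾ m) u ≡ m
subFront-leading []      t m       e = replicate0-+ᴾ t m e
subFront-leading (x ∷ u) t (y ∷ m) e = cong₂ _∷_ (cancel x y) (subFront-leading u t m (ℕP.suc-injective e))
  where
  cancel : ∀ x y → x ℤ.+ y ℤ.- x ≡ y
  cancel = ℤ-Solver.solve-∀

divH-mulH : ∀ gs k h → length h ≤ k → divH k (mulH (+ 1 ∷ gs) h) (+ 1 ∷ gs) ≡ h
divH-mulH gs zero    []      _ = refl
divH-mulH gs (suc k) []      _ with suc (length gs) ≤ᵇ length (replicate (length gs) (+ 0)) in test
... | false = refl
... | true  = ⊥-elim (ℕP.<⇒≱ (ℕP.≤-reflexive (cong suc (List.length-replicate (length gs))))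
                             (ℕP.≤ᵇ⇒≤ _ _ (subst T (sym test) _)))
divH-mulH gs (suc k) (c ∷ h) (s≤s h≤k) with suc (length gs) ≤ᵇ length (mulH (+ 1 ∷ gs) (c ∷ h)) in test
... | false = ⊥-elim (subst T test (ℕP.≤⇒≤ᵇ long))
  where
  long : suc (length gs) ≤ length (mulH (+ 1 ∷ gs) (c ∷ h))
  long = ℕP.≤-trans (ℕP.≤-trans (s≤s (ℕP.m≤m+n (length gs) (length h))) (ℕP.≤-reflexive (sym (ℕP.+-suc _ _))))
                    (ℕP.≤-reflexive (sym (length-mulH (+ 1) gs (c ∷ h))))
... | true  = cong₂ _∷_ lead (begin
  divH k (subFront rest ((c ℤ.* + 1 ℤ.+ + 0) ·ᴾ gs)) (+ 1 ∷ gs)  ≡⟨ cong (λ d → divH k (subFront rest (d ·ᴾ gs)) (+ 1 ∷ gs)) lead ⟩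
  divH k (subFront rest (c ·ᴾ gs)) (+ 1 ∷ gs)                    ≡⟨ cong (λ f → divH k f (+ 1 ∷ gs)) (subFront-leading (c ·ᴾ gs) (length h) _ lengths) ⟩
  divH k (mulH (+ 1 ∷ gs) h) (+ 1 ∷ gs)                          ≡⟨ divH-mulH gs k h h≤k ⟩
  h                                                              ∎)
  where
  open ≡-Reasoning
  lead : c ℤ.* + 1 ℤ.+ + 0 ≡ c
  lead = trans (ℤP.+-identityʳ _) (ℤP.*-identityʳ c)
  rest : List ℤ
  rest = (c ·ᴾ gs ++ replicate (length h) (+ 0)) +ᴾ mulH (+ 1 ∷ gs) h
  lengths : length (mulH (+ 1 ∷ gs) h) ≡ length (c ·ᴾ gs) + length h
  lengths = trans (length-mulH (+ 1) gs h) (cong (_+ length h) (sym (List.length-map (c ℤ.*_) gs)))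

reverse-replicate : ∀ n (a : ℤ) → reverse (replicate n a) ≡ replicate n a
reverse-replicate zero    a = refl
reverse-replicate (suc n) a = begin
  reverse (a ∷ replicate n a)   ≡⟨ List.unfold-reverse a (replicate n a) ⟩
  reverse (replicate n a) ++ [ a ] ≡⟨ cong (_++ [ a ]) (reverse-replicate n a) ⟩
  replicate n a ++ [ a ]        ≡⟨ snoc n ⟩
  a ∷ replicate n a             ∎
  where
  open ≡-Reasoning
  snoc : ∀ n → replicate n a ++ [ a ] ≡ a ∷ replicate n a
  snoc zero    = refl
  snoc (suc n) = cong (a ∷_) (snoc n)

replicate0≈[] : ∀ n → replicate n (+ 0) ≈ []
replicate0≈[] zero    = ≈-refl
replicate0≈[] (suc n) = ≈-trans (∷-cong refl (replicate0≈[] n)) 0∷[]≈[]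

++-[]-+ᴾ : ∀ p q a b → length p ≡ length q → (p ++ [ a ]) +ᴾ (q ++ [ b ]) ≡ (p +ᴾ q) ++ [ a ℤ.+ b ]
++-[]-+ᴾ []      []      a b e = refl
++-[]-+ᴾ (x ∷ p) (y ∷ q) a b e = cong (x ℤ.+ y ∷_) (++-[]-+ᴾ p q a b (ℕP.suc-injective e))

reverse-+ᴾ : ∀ p q → length p ≡ length q → reverse (p +ᴾ q) ≡ reverse p +ᴾ reverse q
reverse-+ᴾ []      []      e = refl
reverse-+ᴾ (a ∷ p) (b ∷ q) e = begin
  reverse (a ℤ.+ b ∷ p +ᴾ q)                     ≡⟨ List.unfold-reverse (a ℤ.+ b) (p +ᴾ q) ⟩
  reverse (p +ᴾ q) ++ [ a ℤ.+ b ]                ≡⟨ cong (_++ [ a ℤ.+ b ]) (reverse-+ᴾ p q e′) ⟩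
  (reverse p +ᴾ reverse q) ++ [ a ℤ.+ b ]        ≡⟨ ++-[]-+ᴾ (reverse p) (reverse q) a b lengths ⟨
  (reverse p ++ [ a ]) +ᴾ (reverse q ++ [ b ])   ≡⟨ cong₂ _+ᴾ_ (List.unfold-reverse a p) (List.unfold-reverse b q) ⟨
  reverse (a ∷ p) +ᴾ reverse (b ∷ q)             ∎
  where
  open ≡-Reasoning
  e′ = ℕP.suc-injective e
  lengths : length (reverse p) ≡ length (reverse q)
  lengths = trans (List.length-reverse p) (trans e′ (sym (List.length-reverse q)))

++-[0]≈ : ∀ p → p ++ [ + 0 ] ≈ p
++-[0]≈ []      = 0∷[]≈[]
++-[0]≈ (a ∷ p) = ∷-cong refl (++-[0]≈ p)

replicate0-++ : ∀ t p → replicate t (+ 0) ++ p ≈ X^ t *ᴾ p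
replicate0-++ zero    p = ≈-sym (*-identityˡ p)
replicate0-++ (suc t) p = ≈-trans (∷-cong refl (replicate0-++ t p)) (≈-sym (X^-suc-* t p))

++-[]≈ : ∀ p c → p ++ [ c ] ≈ p +ᴾ X^ (length p) *ᴾ (c ∷ [])
++-[]≈ []      c = ≈-sym (*-identityˡ (c ∷ []))
++-[]≈ (a ∷ p) c = ≈-trans (∷-cong (sym (ℤP.+-identityʳ a)) (++-[]≈ p c))
                           (≈-sym (+-cong (≈-refl {a ∷ p}) (X^-suc-* (length p) (c ∷ []))))

reverse-mulH : ∀ x gs h → reverse (mulH (x ∷ gs) h) ≈ reverse (x ∷ gs) *ᴾ reverse h
reverse-mulH x gs []      = begin
  reverse (replicate (length gs) (+ 0))  ≡⟨ reverse-replicate (length gs) (+ 0) ⟩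
  replicate (length gs) (+ 0)            ≈⟨ replicate0≈[] (length gs) ⟩
  []                                     ≈⟨ *-zeroʳ (reverse (x ∷ gs)) ⟨
  reverse (x ∷ gs) *ᴾ []                 ∎
  where open ≈-Reasoning
reverse-mulH x gs (c ∷ h) = begin
  reverse (leading +ᴾ shifted)                    ≡⟨ reverse-+ᴾ leading shifted lengths ⟩
  reverse leading +ᴾ reverse shifted              ≈⟨ +-cong leading≈ shifted≈ ⟩
  X^ t *ᴾ ((c ∷ []) *ᴾ g) +ᴾ g *ᴾ reverse h       ≈⟨ factor g (reverse h) (X^ t) (c ∷ []) ⟩
  g *ᴾ (reverse h +ᴾ X^ t *ᴾ (c ∷ []))            ≈⟨ *-congˡ g (≈-sym (subst (λ k → reverse h ++ [ c ] ≈ reverse h +ᴾ X^ k *ᴾ (c ∷ []))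
                                                                            (List.length-reverse h) (++-[]≈ (reverse h) c))) ⟩
  g *ᴾ (reverse h ++ [ c ])                       ≡⟨ cong (g *ᴾ_) (List.unfold-reverse c h) ⟨
  g *ᴾ reverse (c ∷ h)                            ∎
  where
  open ≈-Reasoning
  t = length h
  g = reverse (x ∷ gs)
  leading = c ·ᴾ (x ∷ gs) ++ replicate t (+ 0)
  shifted = + 0 ∷ mulH (x ∷ gs) h
  lengths : length leading ≡ length shifted
  lengths = trans (length-leading c (x ∷ gs) t) (cong suc (sym (length-mulH x gs h)))
  factor : ∀ g h x c → x *ᴾ (c *ᴾ g) +ᴾ g *ᴾ h ≈ g *ᴾ (h +ᴾ x *ᴾ c)
  factor = Solver.solve-∀ polyRing
  leading≈ : reverse leading ≈ X^ t *ᴾ ((c ∷ []) *ᴾ g)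
  leading≈ = begin
    reverse leading                                    ≡⟨ List.reverse-++ (c ·ᴾ (x ∷ gs)) (replicate t (+ 0)) ⟩
    reverse (replicate t (+ 0)) ++ reverse (c ·ᴾ (x ∷ gs)) ≡⟨ cong₂ _++_ (reverse-replicate t (+ 0)) (sym (List.reverse-map (c ℤ.*_) (x ∷ gs))) ⟩
    replicate t (+ 0) ++ c ·ᴾ g                        ≈⟨ replicate0-++ t (c ·ᴾ g) ⟩
    X^ t *ᴾ (c ·ᴾ g)                                   ≈⟨ *-congˡ (X^ t) (const-*ᴾ c g) ⟨
    X^ t *ᴾ ((c ∷ []) *ᴾ g)                            ∎
  shifted≈ : reverse shifted ≈ g *ᴾ reverse h
  shifted≈ = begin
    reverse shifted                         ≡⟨ List.unfold-reverse (+ 0) (mulH (x ∷ gs) h) ⟩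
    reverse (mulH (x ∷ gs) h) ++ [ + 0 ]    ≈⟨ ++-[0]≈ _ ⟩
    reverse (mulH (x ∷ gs) h)               ≈⟨ reverse-mulH x gs h ⟩
    g *ᴾ reverse h                          ∎

record Monic (p : Poly) : Set where
  constructor monic
  field
    {lowerCoeffs} : List ℤ
    normalForm≡   : normalForm p ≡ + 1 ∷ lowerCoeffs

Monic-cong : ∀ {p q} → p ≈ q → Monic p → Monic q
Monic-cong e (monic nf) = monic (trans (sym (normalForm-cong e)) nf)

normalForm-* : ∀ g h gs c hs → normalForm g ≡ + 1 ∷ gs → normalForm h ≡ c ∷ hs → ¬ c ≡ + 0 →
               normalForm (g *ᴾ h) ≡ mulH (+ 1 ∷ gs) (c ∷ hs)
normalForm-* g h gs c hs nfg nfh c≢0 =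
  trans (normalForm-cong product) (normalForm-reverse (mulH (+ 1 ∷ gs) (c ∷ hs)) head≢0)
  where
  reverse-normalForm′ : ∀ p {l} → normalForm p ≡ l → reverse l ≈ p
  reverse-normalForm′ p refl = reverse-normalForm p
  product : g *ᴾ h ≈ reverse (mulH (+ 1 ∷ gs) (c ∷ hs))
  product = ≈-sym (≈-trans (reverse-mulH (+ 1) gs (c ∷ hs))
                           (*-cong (reverse-normalForm′ g nfg) (reverse-normalForm′ h nfh)))
  head≢0 : ¬ c ℤ.* + 1 ℤ.+ + 0 ≡ + 0
  head≢0 e = c≢0 (trans (sym (trans (ℤP.+-identityʳ _) (ℤP.*-identityʳ c))) e)

Monic-* : ∀ {g h} → Monic g → Monic h → Monic (g *ᴾ h)
Monic-* {g} {h} (monic {gs} nfg) (monic {hs} nfh) = monic (normalForm-* g h gs (+ 1) hs nfg nfh (λ ()))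

length-normalForm-* : ∀ {g h} → Monic g → Monic h →
                      length (normalForm (g *ᴾ h)) + 1 ≡ length (normalForm g) + length (normalForm h)
length-normalForm-* {g} {h} (monic {gs} nfg) (monic {hs} nfh) = begin
  length (normalForm (g *ᴾ h)) + 1               ≡⟨ cong (λ l → length l + 1) (normalForm-* g h gs (+ 1) hs nfg nfh (λ ())) ⟩
  length (mulH (+ 1 ∷ gs) (+ 1 ∷ hs)) + 1         ≡⟨ cong (_+ 1) (length-mulH (+ 1) gs (+ 1 ∷ hs)) ⟩
  length gs + suc (length hs) + 1                ≡⟨ ℕP.+-comm (length gs + suc (length hs)) 1 ⟩
  suc (length gs) + suc (length hs)              ≡⟨ cong₂ (λ l l′ → length l + length l′) nfg nfh ⟨
  length (normalForm g) + length (normalForm h)  ∎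
  where open ≡-Reasoning

divᴾ-exact : ∀ {f g h} → Monic f → Monic g → g *ᴾ h ≈ f → divᴾ f g ≈ h × Monic h
divᴾ-exact {f} {g} {h} (monic {fs} nff) (monic {gs} nfg) gh≈f with normalForm h in nfh | normalForm-shape h
... | []     | _ = ⊥-elim (1∷fs≢[] (trans (sym nff) (normalForm-cong f≈[])))
  where
  1∷fs≢[] : ¬ + 1 ∷ fs ≡ []
  1∷fs≢[] ()
  f≈[] : f ≈ []
  f≈[] = begin
    f                          ≈⟨ gh≈f ⟨
    g *ᴾ h                     ≈⟨ *-congˡ g (subst (λ l → reverse l ≈ h) nfh (reverse-normalForm h)) ⟨
    g *ᴾ []                    ≈⟨ *-zeroʳ g ⟩
    []                         ∎
    where open ≈-Reasoning
... | c ∷ hs | inj₂ c≢0 = quotient≈h , monic (trans nfh (cong (_∷ hs) c≡1))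
  where
  nff′ : normalForm f ≡ mulH (+ 1 ∷ gs) (c ∷ hs)
  nff′ = trans (normalForm-cong (≈-sym gh≈f)) (normalForm-* g h gs c hs nfg nfh c≢0)
  fuel : length (c ∷ hs) ≤ length f
  fuel = begin
    length (c ∷ hs)                        ≤⟨ ℕP.m≤n+m (length (c ∷ hs)) (length gs) ⟩
    length gs + length (c ∷ hs)            ≡⟨ length-mulH (+ 1) gs (c ∷ hs) ⟨
    length (mulH (+ 1 ∷ gs) (c ∷ hs))      ≡⟨ cong length nff′ ⟨
    length (normalForm f)                  ≤⟨ length-normalForm f ⟩
    length f                               ∎
    where open ℕP.≤-Reasoning
  quotient≈h : divᴾ f g ≈ h
  quotient≈h = begin
    reverse (divH (length f) (normalForm f) (normalForm g))        ≡⟨ cong₂ (λ l l′ → reverse (divH (length f) l l′)) nff′ nfg ⟩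
    reverse (divH (length f) (mulH (+ 1 ∷ gs) (c ∷ hs)) (+ 1 ∷ gs)) ≡⟨ cong reverse (divH-mulH gs (length f) (c ∷ hs) fuel) ⟩
    reverse (c ∷ hs)                                              ≡⟨ cong reverse nfh ⟨
    reverse (normalForm h)                                        ≈⟨ reverse-normalForm h ⟩
    h                                                             ∎
    where open ≈-Reasoning
  c≡1 : c ≡ + 1
  c≡1 = begin
    c                       ≡⟨ trans (ℤP.+-identityʳ _) (ℤP.*-identityʳ c) ⟨
    c ℤ.* + 1 ℤ.+ + 0       ≡⟨ cong (λ { [] → + 0 ; (x ∷ _) → x }) (trans (sym nff′) nff) ⟩
    + 1                     ∎
    where open ≡-Reasoning

normalForm-xⁿ-1 : ∀ n → normalForm (xⁿ-1 (suc n)) ≡ + 1 ∷ replicate n (+ 0) ++ [ -[1+ 0 ] ]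
normalForm-xⁿ-1 n = cong dropZeros (begin
  reverse (-[1+ 0 ] ∷ replicate n (+ 0) ++ 1ᴾ)             ≡⟨ List.unfold-reverse -[1+ 0 ] (replicate n (+ 0) ++ 1ᴾ) ⟩
  reverse (replicate n (+ 0) ++ 1ᴾ) ++ [ -[1+ 0 ] ]        ≡⟨ cong (_++ [ -[1+ 0 ] ]) (List.reverse-++ (replicate n (+ 0)) 1ᴾ) ⟩
  + 1 ∷ reverse (replicate n (+ 0)) ++ [ -[1+ 0 ] ]        ≡⟨ cong (λ l → + 1 ∷ l ++ [ -[1+ 0 ] ]) (reverse-replicate n (+ 0)) ⟩
  + 1 ∷ replicate n (+ 0) ++ [ -[1+ 0 ] ]                  ∎)
  where open ≡-Reasoning

Monic-xⁿ-1 : ∀ {n} → 0 < n → Monic (xⁿ-1 n)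
Monic-xⁿ-1 {suc n} _ = monic (normalForm-xⁿ-1 n)

length-normalForm-xⁿ-1 : ∀ {n} → 0 < n → length (normalForm (xⁿ-1 n)) ≡ suc n
length-normalForm-xⁿ-1 {suc n} _ = begin
  length (normalForm (xⁿ-1 (suc n)))                     ≡⟨ cong length (normalForm-xⁿ-1 n) ⟩
  suc (length (replicate n (+ 0) ++ [ -[1+ 0 ] ]))       ≡⟨ cong suc (List.length-++ (replicate n (+ 0))) ⟩
  suc (length (replicate n (+ 0)) + 1)                   ≡⟨ cong (λ m → suc (m + 1)) (List.length-replicate n) ⟩
  suc (n + 1)                                            ≡⟨ cong suc (ℕP.+-comm n 1) ⟩
  suc (suc n)                                            ∎
  where open ≡-Reasoning

normalForm-geom : ∀ n → normalForm (geom (suc n)) ≡ + 1 ∷ replicate n (+ 1)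
normalForm-geom n = cong dropZeros (reverse-replicate (suc n) (+ 1))

Monic-geom : ∀ {n} → 0 < n → Monic (geom n)
Monic-geom {suc n} _ = monic (normalForm-geom n)

length-normalForm-geom : ∀ {n} → 0 < n → length (normalForm (geom n)) ≡ n
length-normalForm-geom {suc n} _ = trans (cong length (normalForm-geom n)) (cong suc (List.length-replicate n))

-- Coefficient bounds

Bit : ℤ → Set
Bit c = c ≡ + 0 ⊎ c ≡ + 1

Bits : Poly → Set
Bits p = ∀ n → Bit (coeff p n)

bit-shift : ∀ m f → (∀ n → Bit (f n)) → ∀ n → Bit (shift m f n)
bit-shift m f bits n with m ℕ.≤? n
... | yes _ = bits (n ∸ m)
... | no  _ = inj₁ refl

∣bit-bit∣≤1 : ∀ {a b} → Bit a → Bit b → ∣ a ℤ.- b ∣ ≤ 1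
∣bit-bit∣≤1 (inj₁ refl) (inj₁ refl) = z≤n
∣bit-bit∣≤1 (inj₁ refl) (inj₂ refl) = s≤s z≤n
∣bit-bit∣≤1 (inj₂ refl) (inj₁ refl) = s≤s z≤n
∣bit-bit∣≤1 (inj₂ refl) (inj₂ refl) = z≤n

bits-geom : ∀ m → Bits (geom m)
bits-geom zero    n       = inj₁ refl
bits-geom (suc m) zero    = inj₂ refl
bits-geom (suc m) (suc n) = bits-geom m n

shift-< : ∀ {m n} f → n < m → shift m f n ≡ + 0
shift-< {m} {n} f n<m with m ℕ.≤? n
... | yes m≤n = ⊥-elim (ℕP.<⇒≱ n<m m≤n)
... | no  _   = refl

shift≢0 : ∀ m f n → ¬ shift m f n ≡ + 0 → m ≤ n × ¬ f (n ∸ m) ≡ + 0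
shift≢0 m f n ≢0 with m ℕ.≤? n
... | yes m≤n = m≤n , ≢0
... | no  _   = ⊥-elim (≢0 refl)

coeff-dilate-∷ : ∀ r a p n → coeff (dilate r (a ∷ p)) n ≡ coeff (a ∷ []) n ℤ.+ shift r (coeff (dilate r p)) n
coeff-dilate-∷ r a p n = trans (coeff-+ᴾ (a ∷ []) (X^ r *ᴾ dilate r p) n) (cong (ℤ._+_ (coeff (a ∷ []) n)) (coeff-X^* r (dilate r p) n))

coeff-dilate-0 : ∀ r p → 0 < r → coeff (dilate r p) 0 ≡ coeff p 0
coeff-dilate-0 r []      _   = refl
coeff-dilate-0 r (a ∷ p) r>0 =
  trans (coeff-dilate-∷ r a p 0) (trans (cong (ℤ._+_ a) (shift-< (coeff (dilate r p)) r>0)) (ℤP.+-identityʳ a))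

bits-dilate : ∀ r p → 0 < r → Bits p → Bits (dilate r p)
bits-dilate r []      _   _    n       = inj₁ refl
bits-dilate r (a ∷ p) r>0 bits zero    = subst Bit (sym (coeff-dilate-0 r (a ∷ p) r>0)) (bits 0)
bits-dilate r (a ∷ p) r>0 bits (suc n) = subst Bit (sym (trans (coeff-dilate-∷ r a p (suc n)) (ℤP.+-identityˡ _)))
  (bit-shift r _ (bits-dilate r p r>0 (λ n → bits (suc n))) (suc n))

dilate-support : ∀ r p n → ¬ coeff (dilate r p) n ≡ + 0 → r ∣ n
dilate-support r []      n       ≢0 = ⊥-elim (≢0 refl)
dilate-support r (a ∷ p) zero    ≢0 = r ∣0
dilate-support r (a ∷ p) (suc n) ≢0 with shift≢0 r (coeff (dilate r p)) (suc n)
  (λ shift≡0 → ≢0 (trans (coeff-dilate-∷ r a p (suc n)) (trans (ℤP.+-identityˡ _) shift≡0)))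
... | r≤n , ≢0′ = subst (r ∣_) (ℕP.m+[n∸m]≡n r≤n) (∣m∣n⇒∣m+n ∣-refl (dilate-support r p (suc n ∸ r) ≢0′))

coeff-≥length : ∀ p m → length p ≤ m → coeff p m ≡ + 0
coeff-≥length []      m       _         = refl
coeff-≥length (a ∷ p) (suc m) (s≤s le) = coeff-≥length p m le

*-const : ∀ p d → p *ᴾ (d ∷ []) ≈ d ·ᴾ p
*-const p d = ≈-trans (*-comm p (d ∷ [])) (const-*ᴾ d p)

coeff-*-dilate : ∀ r p s → length p ≤ r → ∀ j i → i < r →
                 coeff (p *ᴾ dilate r s) (r * j + i) ≡ coeff s j ℤ.* coeff p i
coeff-*-dilate r p []      _  j       i i<r = trans (coeff-≡ (*-zeroʳ p) _) (sym (ℤP.*-zeroˡ (coeff p i)))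
coeff-*-dilate r p (d ∷ s) lp j       i i<r =
  trans (coeff-≡ (*-distribˡ-+ p (d ∷ []) (X^ r *ᴾ dilate r s)) (r * j + i))
        (trans (coeff-+ᴾ (p *ᴾ (d ∷ [])) _ _) (split j))
  where
  exchange : ∀ p x y → p *ᴾ (x *ᴾ y) ≈ x *ᴾ (p *ᴾ y)
  exchange = Solver.solve-∀ polyRing
  low : ∀ m → coeff (p *ᴾ (d ∷ [])) m ≡ d ℤ.* coeff p m
  low m = trans (coeff-≡ (*-const p d) m) (coeff-·ᴾ d p m)
  high : ∀ m → coeff (p *ᴾ (X^ r *ᴾ dilate r s)) m ≡ coeff (X^ r *ᴾ (p *ᴾ dilate r s)) m
  high = coeff-≡ (exchange p (X^ r) (dilate r s))
  split : ∀ j → coeff (p *ᴾ (d ∷ [])) (r * j + i) ℤ.+ coeff (p *ᴾ (X^ r *ᴾ dilate r s)) (r * j + i)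
                ≡ coeff (d ∷ s) j ℤ.* coeff p i
  split zero = begin
    coeff (p *ᴾ (d ∷ [])) (r * 0 + i) ℤ.+ coeff (p *ᴾ (X^ r *ᴾ dilate r s)) (r * 0 + i)
      ≡⟨ cong (λ k → coeff (p *ᴾ (d ∷ [])) (k + i) ℤ.+ coeff (p *ᴾ (X^ r *ᴾ dilate r s)) (k + i)) (ℕP.*-zeroʳ r) ⟩
    coeff (p *ᴾ (d ∷ [])) i ℤ.+ coeff (p *ᴾ (X^ r *ᴾ dilate r s)) i
      ≡⟨ cong₂ ℤ._+_ (low i) (trans (high i) (coeff-X^*-< r _ i i<r)) ⟩
    d ℤ.* coeff p i ℤ.+ + 0
      ≡⟨ ℤP.+-identityʳ _ ⟩
    d ℤ.* coeff p i ∎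
    where open ≡-Reasoning
  split (suc j) = begin
    coeff (p *ᴾ (d ∷ [])) (r * suc j + i) ℤ.+ coeff (p *ᴾ (X^ r *ᴾ dilate r s)) (r * suc j + i)
      ≡⟨ cong (λ k → coeff (p *ᴾ (d ∷ [])) k ℤ.+ coeff (p *ᴾ (X^ r *ᴾ dilate r s)) k) (unfold r j i) ⟩
    coeff (p *ᴾ (d ∷ [])) (r + (r * j + i)) ℤ.+ coeff (p *ᴾ (X^ r *ᴾ dilate r s)) (r + (r * j + i))
      ≡⟨ cong₂ ℤ._+_ (trans (low _) (trans (cong (d ℤ.*_) (coeff-≥length p _ (ℕP.≤-trans lp (ℕP.m≤m+n r _)))) (ℤP.*-zeroʳ d)))
                     (trans (high _) (coeff-X^*-+ r _ _)) ⟩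
    + 0 ℤ.+ coeff (p *ᴾ dilate r s) (r * j + i)
      ≡⟨ ℤP.+-identityˡ _ ⟩
    coeff (p *ᴾ dilate r s) (r * j + i)
      ≡⟨ coeff-*-dilate r p s lp j i i<r ⟩
    coeff s j ℤ.* coeff p i ∎
    where
    open ≡-Reasoning
    unfold : ∀ r j i → r * suc j + i ≡ r + (r * j + i)
    unfold = ℕ-Solver.solve-∀

coeff-*-dilate-bounded : ∀ r p s → 0 < r → length p ≤ r →
                         (∀ i → ∣ coeff p i ∣ ≤ 1) → (∀ j → ∣ coeff s j ∣ ≤ 1) →
                         ∀ m → ∣ coeff (p *ᴾ dilate r s) m ∣ ≤ 1
coeff-*-dilate-bounded r p s r>0 lp p-bounded s-bounded m =
  subst (λ c → ∣ c ∣ ≤ 1) (sym (trans (cong (coeff (p *ᴾ dilate r s)) m≡) (coeff-*-dilate r p s lp (m / r) (m % r) (m%n<n m r))))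
        (subst (_≤ 1) (sym (ℤP.abs-* (coeff s (m / r)) (coeff p (m % r)))) (ℕP.*-mono-≤ (s-bounded (m / r)) (p-bounded (m % r))))
  where
  instance _ = ℕ.>-nonZero r>0
  m≡ : m ≡ r * (m / r) + m % r
  m≡ = trans (m≡m%n+[m/n]*n m r) (trans (ℕP.+-comm (m % r) _) (cong (_+ m % r) (ℕP.*-comm (m / r) r)))

Flat-coeff : ∀ p → (∀ n → ∣ coeff p n ∣ ≤ 1) → (Σ ℕ λ n → ∣ coeff p n ∣ ≡ 1) → Flat p
Flat-coeff p bounded (n , attained) = all p bounded , any p n attained
  where
  all : ∀ p → (∀ n → ∣ coeff p n ∣ ≤ 1) → All (λ c → ∣ c ∣ ≤ 1) p
  all []      _       = []
  all (a ∷ p) bounded = bounded 0 ∷ all p (λ n → bounded (suc n))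
  any : ∀ p n → ∣ coeff p n ∣ ≡ 1 → Any (λ c → ∣ c ∣ ≡ 1) p
  any (a ∷ p) zero    e = here e
  any (a ∷ p) (suc n) e = there (any p n e)

-- Divisors of p, pq and pqr

prime⇒≥2 : ∀ {p} → Prime p → 2 ≤ p
prime⇒≥2 {p} pp = ℕ.nonTrivial⇒n>1 p {{prime⇒nonTrivial pp}}

prime⇒>0 : ∀ {p} → Prime p → 0 < p
prime⇒>0 pp = ℕP.≤-trans (s≤s z≤n) (prime⇒≥2 pp)

coprime⇒inverse : ∀ {a b} → Coprime a b → 0 < a → Σ ℕ λ s → Σ ℕ λ k → a * s ≡ 1 + b * k
coprime⇒inverse {a} {b} coprime _ with coprime-Bézout coprime
... | Bézout.+- x y eq = x , y , trans (ℕP.*-comm a x) (trans (sym eq) (cong suc (ℕP.*-comm y b)))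
coprime⇒inverse {suc a′} {b} coprime _ | Bézout.-+ x y eq = w , y * a′ , ℕP.+-cancelʳ-≡ _ _ _ chain
  where
  -- From 1 + x a = y b, the number w = b y − x satisfies a w = 1 + b y (a − 1).
  a = suc a′
  x≤by : x ≤ b * y
  x≤by = ℕP.≤-trans (ℕP.m≤m*n x a) (ℕP.≤-trans (ℕP.n≤1+n _) (ℕP.≤-reflexive (trans eq (ℕP.*-comm y b))))
  w = b * y ∸ x
  chain : a * w + a * x ≡ (1 + b * (y * a′)) + a * x
  chain = begin
    a * w + a * x                ≡⟨ ℕP.*-distribˡ-+ a w x ⟨
    a * (w + x)                  ≡⟨ cong (a *_) (ℕP.m∸n+n≡m x≤by) ⟩
    a * (b * y)                  ≡⟨⟩
    b * y + a′ * (b * y)         ≡⟨ cong (_+ a′ * (b * y)) (trans (ℕP.*-comm b y) (sym eq)) ⟩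
    (1 + x * a) + a′ * (b * y)   ≡⟨ regroup x a′ b y ⟩
    (1 + b * (y * a′)) + a * x   ∎
    where
    open ≡-Reasoning
    regroup : ∀ x a′ b y → (1 + x * suc a′) + a′ * (b * y) ≡ (1 + b * (y * a′)) + suc a′ * x
    regroup = ℕ-Solver.solve-∀

∣-prime-* : ∀ {p m d} → Prime p → d ∣ p * m → d ∣ m ⊎ Σ ℕ λ d′ → d ≡ p * d′ × d′ ∣ m
∣-prime-* {p} {m} {d} pp d∣pm with p ∣? d
... | yes (divides d′ d≡d′p) = inj₂ (d′ , d≡pd′ , *-cancelˡ-∣ p {{prime⇒nonZero pp}} (subst (_∣ p * m) d≡pd′ d∣pm))
  where
  d≡pd′ : d ≡ p * d′
  d≡pd′ = trans d≡d′p (ℕP.*-comm d′ p)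
... | no p∤d = inj₁ (coprime-divisor coprime d∣pm)
  where
  coprime : Coprime d p
  coprime (c∣d , c∣p) with prime⇒irreducible pp c∣p
  ... | inj₁ c≡1 = c≡1
  ... | inj₂ refl = ⊥-elim (p∤d c∣d)

∣-semiprime : ∀ {a b e} → Prime a → Prime b → e ∣ a * b → e ≡ 1 ⊎ e ≡ a ⊎ e ≡ b ⊎ e ≡ a * b
∣-semiprime {a} pa pb e∣ab with ∣-prime-* pa e∣ab
... | inj₁ e∣b with prime⇒irreducible pb e∣b
...   | inj₁ refl = inj₁ refl
...   | inj₂ refl = inj₂ (inj₂ (inj₁ refl))
∣-semiprime {a} pa pb e∣ab | inj₂ (e′ , refl , e′∣b) with prime⇒irreducible pb e′∣b
...   | inj₁ refl = inj₂ (inj₁ (ℕP.*-identityʳ a))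
...   | inj₂ refl = inj₂ (inj₂ (inj₂ refl))

record ListsProperDivisors (n : ℕ) (L : List ℕ) : Set where
  field
    sound    : ∀ {d} → d ∈ L → d ∣ n × 0 < d × d < n
    complete : ∀ {d} → d ∣ n → 0 < d → d < n → d ∈ L
open ListsProperDivisors

properDivisors-lists : ∀ n → ListsProperDivisors n (properDivisors n)
properDivisors-lists n = record { sound = sound′ ; complete = complete′ }
  where
  sound′ : ∀ {d} → d ∈ properDivisors n → d ∣ n × 0 < d × d < n
  sound′ d∈ with ∈.∈-filter⁻ (_∣? n) {xs = map suc (upTo (n ∸ 1))} d∈
  ... | d∈range , d∣n with ∈.∈-map⁻ suc d∈range
  ...   | i , i∈ , refl = d∣n , s≤s z≤n , below n (∈.∈-upTo⁻ i∈)
    where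
    below : ∀ {i} n → i < n ∸ 1 → suc i < n
    below (suc n) i<n = s≤s i<n
  complete′ : ∀ {d} → d ∣ n → 0 < d → d < n → d ∈ properDivisors n
  complete′ {suc i} d∣n _ d<n = ∈.∈-filter⁺ (_∣? n) (∈.∈-map⁺ suc (∈.∈-upTo⁺ (below n d<n))) d∣n
    where
    below : ∀ n → suc i < n → i < n ∸ 1
    below (suc n) (s≤s i<n) = i<n

properDivisors-sorted : ∀ n → AllPairs _<_ (properDivisors n)
properDivisors-sorted n =
  AllPairs.filter⁺ (_∣? n) (AllPairs.map⁺ (AllPairs.applyUpTo⁺₁ (λ i → i) (n ∸ 1) (λ i<j _ → s≤s i<j)))

sorted-≡ : ∀ {L M} → AllPairs _<_ L → AllPairs _<_ M →
           (∀ {x} → x ∈ L → x ∈ M) → (∀ {x} → x ∈ M → x ∈ L) → L ≡ M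
sorted-≡ {[]}    {[]}    _ _ _ _ = refl
sorted-≡ {[]}    {b ∷ M} _ _ _ M⊆L with M⊆L (here refl)
... | ()
sorted-≡ {a ∷ L} {[]}    _ _ L⊆M _ with L⊆M (here refl)
... | ()
sorted-≡ {a ∷ L} {b ∷ M} (a<L ∷ sL) (b<M ∷ sM) L⊆M M⊆L with heads
  where
  heads : a ≡ b
  heads with L⊆M (here refl) | M⊆L (here refl)
  ... | here a≡b  | _         = a≡b
  ... | there a∈M | here b≡a  = sym b≡a
  ... | there a∈M | there b∈L = ⊥-elim (ℕP.<-asym (All.lookup b<M a∈M) (All.lookup a<L b∈L))
... | refl = cong (a ∷_) (sorted-≡ sL sM L⊆M′ M⊆L′)
  where
  L⊆M′ : ∀ {x} → x ∈ L → x ∈ M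
  L⊆M′ x∈L with L⊆M (there x∈L)
  ... | here refl = ⊥-elim (ℕP.<-irrefl refl (All.lookup a<L x∈L))
  ... | there x∈M = x∈M
  M⊆L′ : ∀ {x} → x ∈ M → x ∈ L
  M⊆L′ x∈M with M⊆L (there x∈M)
  ... | here refl = ⊥-elim (ℕP.<-irrefl refl (All.lookup b<M x∈M))
  ... | there x∈L = x∈L

properDivisors-≡ : ∀ {n L} → AllPairs _<_ L → ListsProperDivisors n L → properDivisors n ≡ L
properDivisors-≡ {n} sorted lists = sorted-≡ (properDivisors-sorted n) sorted
  (λ d∈ → let (d∣n , d>0 , d<n) = sound (properDivisors-lists n) d∈ in complete lists d∣n d>0 d<n)
  (λ d∈ → let (d∣n , d>0 , d<n) = sound lists d∈ in complete (properDivisors-lists n) d∣n d>0 d<n)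

ListsProperDivisors-↭ : ∀ {n L M} → L ↭ M → ListsProperDivisors n L → ListsProperDivisors n M
ListsProperDivisors-↭ L↭M lists = record
  { sound    = λ d∈M → sound lists (∈-resp-↭ (↭-sym L↭M) d∈M)
  ; complete = λ d∣n d>0 d<n → ∈-resp-↭ L↭M (complete lists d∣n d>0 d<n) }

properDivisors-prime : ∀ {a} → Prime a → properDivisors a ≡ [ 1 ]
properDivisors-prime {a} pa = properDivisors-≡ ([] ∷ []) (record { sound = sound′ ; complete = complete′ })
  where
  sound′ : ∀ {d} → d ∈ [ 1 ] → d ∣ a × 0 < d × d < a
  sound′ (here refl) = 1∣ a , s≤s z≤n , prime⇒≥2 pa
  complete′ : ∀ {d} → d ∣ a → 0 < d → d < a → d ∈ [ 1 ]
  complete′ d∣a _ d<a with prime⇒irreducible pa d∣a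
  ... | inj₁ refl = here refl
  ... | inj₂ refl = ⊥-elim (ℕP.<-irrefl refl d<a)

properDivisors-semiprime : ∀ {a b} → Prime a → Prime b → a < b → properDivisors (a * b) ≡ 1 ∷ a ∷ b ∷ []
properDivisors-semiprime {a} {b} pa pb a<b =
  properDivisors-≡ (Linked⇒AllPairs ℕP.<-trans (prime⇒≥2 pa ∷ a<b ∷ [-])) (record { sound = sound′ ; complete = complete′ })
  where
  a<ab : a < a * b
  a<ab = ℕP.m<m*n a b {{prime⇒nonZero pa}} (prime⇒≥2 pb)
  b<ab : b < a * b
  b<ab = subst (b <_) (ℕP.*-comm b a) (ℕP.m<m*n b a {{prime⇒nonZero pb}} (prime⇒≥2 pa))
  sound′ : ∀ {d} → d ∈ 1 ∷ a ∷ b ∷ [] → d ∣ a * b × 0 < d × d < a * b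
  sound′ (here refl)                 = 1∣ (a * b) , s≤s z≤n , ℕP.<-trans (prime⇒≥2 pa) a<ab
  sound′ (there (here refl))         = m∣m*n b , prime⇒>0 pa , a<ab
  sound′ (there (there (here refl))) = n∣m*n a , prime⇒>0 pb , b<ab
  complete′ : ∀ {d} → d ∣ a * b → 0 < d → d < a * b → d ∈ 1 ∷ a ∷ b ∷ []
  complete′ d∣ab _ d<ab with ∣-semiprime pa pb d∣ab
  ... | inj₁ refl               = here refl
  ... | inj₂ (inj₁ refl)        = there (here refl)
  ... | inj₂ (inj₂ (inj₁ refl)) = there (there (here refl))
  ... | inj₂ (inj₂ (inj₂ refl)) = ⊥-elim (ℕP.<-irrefl refl d<ab)

cofactor⇒proper : ∀ {d e n} → d * e ≡ n → 0 < d → 2 ≤ e → d ∣ n × 0 < d × d < n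
cofactor⇒proper {d} {e} refl d>0 e≥2 = m∣m*n e , d>0 , ℕP.m<m*n d e {{ℕ.>-nonZero d>0}} e≥2

module _ {p q r : ℕ} (pp : Prime p) (pq : Prime q) (pr : Prime r) (p<q : p < q) (q<r : q < r) where

  private instance
    p≢0 = prime⇒nonZero pp
    q≢0 = prime⇒nonZero pq
    r≢0 = prime⇒nonZero pr

  private
    2≤* : ∀ {a} b → 2 ≤ a → .{{NonZero b}} → 2 ≤ a * b
    2≤* {a} b a≥2 = ℕP.≤-trans a≥2 (ℕP.m≤m*n a b)

    lists : ListsProperDivisors (p * q * r) (1 ∷ p ∷ q ∷ p * q ∷ r ∷ p * r ∷ q * r ∷ [])
    lists = record { sound = sound′ ; complete = complete′ }
      where
      middle : ∀ p q r → q * (p * r) ≡ p * q * r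
      middle = ℕ-Solver.solve-∀
      outer : ∀ p q r → p * r * q ≡ p * q * r
      outer = ℕ-Solver.solve-∀
      rotate : ∀ p q r → q * r * p ≡ p * q * r
      rotate = ℕ-Solver.solve-∀
      sound′ : ∀ {d} → d ∈ 1 ∷ p ∷ q ∷ p * q ∷ r ∷ p * r ∷ q * r ∷ [] → d ∣ p * q * r × 0 < d × d < p * q * r
      sound′ (here refl) =
        cofactor⇒proper (ℕP.*-identityˡ (p * q * r)) (s≤s z≤n) (2≤* r (2≤* q (prime⇒≥2 pp)))
      sound′ (there (here refl)) =
        cofactor⇒proper (sym (ℕP.*-assoc p q r)) (prime⇒>0 pp) (2≤* r (prime⇒≥2 pq))
      sound′ (there (there (here refl))) =
        cofactor⇒proper (middle p q r) (prime⇒>0 pq) (2≤* r (prime⇒≥2 pp))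
      sound′ (there (there (there (here refl)))) =
        cofactor⇒proper refl (ℕP.*-mono-< (prime⇒>0 pp) (prime⇒>0 pq)) (prime⇒≥2 pr)
      sound′ (there (there (there (there (here refl))))) =
        cofactor⇒proper (ℕP.*-comm r (p * q)) (prime⇒>0 pr) (2≤* q (prime⇒≥2 pp))
      sound′ (there (there (there (there (there (here refl)))))) =
        cofactor⇒proper (outer p q r) (ℕP.*-mono-< (prime⇒>0 pp) (prime⇒>0 pr)) (prime⇒≥2 pq)
      sound′ (there (there (there (there (there (there (here refl))))))) =
        cofactor⇒proper (rotate p q r) (ℕP.*-mono-< (prime⇒>0 pq) (prime⇒>0 pr)) (prime⇒≥2 pp)
      complete′ : ∀ {d} → d ∣ p * q * r → 0 < d → d < p * q * r → d ∈ 1 ∷ p ∷ q ∷ p * q ∷ r ∷ p * r ∷ q * r ∷ []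
      complete′ {d} d∣n _ d<n with ∣-prime-* pr (subst (d ∣_) (ℕP.*-comm (p * q) r) d∣n)
      ... | inj₁ d∣pq with ∣-semiprime pp pq d∣pq
      ...   | inj₁ refl               = here refl
      ...   | inj₂ (inj₁ refl)        = there (here refl)
      ...   | inj₂ (inj₂ (inj₁ refl)) = there (there (here refl))
      ...   | inj₂ (inj₂ (inj₂ refl)) = there (there (there (here refl)))
      complete′ d∣n _ d<n | inj₂ (e , refl , e∣pq) with ∣-semiprime pp pq e∣pq
      ...   | inj₁ refl               = there (there (there (there (here (ℕP.*-identityʳ r)))))
      ...   | inj₂ (inj₁ refl)        = there (there (there (there (there (here (ℕP.*-comm r p))))))
      ...   | inj₂ (inj₂ (inj₁ refl)) = there (there (there (there (there (there (here (ℕP.*-comm r q)))))))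
      ...   | inj₂ (inj₂ (inj₂ refl)) = ⊥-elim (ℕP.<-irrefl (ℕP.*-comm r (p * q)) d<n)

    q<pq : q < p * q
    q<pq = subst (q <_) (ℕP.*-comm q p) (ℕP.m<m*n q p (prime⇒≥2 pp))

    r<pr : r < p * r
    r<pr = subst (r <_) (ℕP.*-comm r p) (ℕP.m<m*n r p (prime⇒≥2 pp))

  properDivisors-pqr : properDivisors (p * q * r) ↭ 1 ∷ p ∷ q ∷ p * q ∷ r ∷ p * r ∷ q * r ∷ []
  properDivisors-pqr with ℕP.<-cmp (p * q) r
  ... | tri< pq<r _ _ = ↭-reflexive (properDivisors-≡ sorted lists)
    where
    sorted : AllPairs _<_ (1 ∷ p ∷ q ∷ p * q ∷ r ∷ p * r ∷ q * r ∷ [])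
    sorted = Linked⇒AllPairs ℕP.<-trans
      (prime⇒≥2 pp ∷ p<q ∷ q<pq ∷ pq<r ∷ r<pr ∷ ℕP.*-monoˡ-< r p<q ∷ [-])
  ... | tri> _ _ r<pq =
    subst (_↭ 1 ∷ p ∷ q ∷ p * q ∷ r ∷ p * r ∷ q * r ∷ []) (sym (properDivisors-≡ sorted (ListsProperDivisors-↭ reorder lists)))
          (↭-sym reorder)
    where
    reorder : 1 ∷ p ∷ q ∷ p * q ∷ r ∷ p * r ∷ q * r ∷ [] ↭ 1 ∷ p ∷ q ∷ r ∷ p * q ∷ p * r ∷ q * r ∷ []
    reorder = prep 1 (prep p (prep q (swap (p * q) r ↭-refl)))
    sorted : AllPairs _<_ (1 ∷ p ∷ q ∷ r ∷ p * q ∷ p * r ∷ q * r ∷ [])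
    sorted = Linked⇒AllPairs ℕP.<-trans
      (prime⇒≥2 pp ∷ p<q ∷ q<r ∷ r<pq ∷ ℕP.*-monoʳ-< p q<r ∷ ℕP.*-monoˡ-< r p<q ∷ [-])
  ... | tri≈ _ pq≡r _ with prime⇒irreducible pr (subst (p ∣_) pq≡r (m∣m*n q))
  ...   | inj₁ refl = ⊥-elim (ℕP.<-irrefl refl (prime⇒≥2 pp))
  ...   | inj₂ refl = ⊥-elim (ℕP.<-irrefl refl (ℕP.<-trans p<q q<r))

prodᴾ-↭ : ∀ {ps qs} → ps ↭ qs → prodᴾ ps ≈ prodᴾ qs
prodᴾ-↭ ps↭qs = Permutationₛ.foldr-commMonoid ≈-setoid
  (CommutativeRing.*-isCommutativeMonoid polyCommutativeRing) (↭⇒↭ₛ′ ≈-isEquivalence ps↭qs)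

-- φ is the polynomial that cyc computes for n once its fuel reaches f.
record Cyclotomic (f n : ℕ) (φ : Poly) : Set where
  field
    cyc≈    : ∀ {k} → f ≤ k → cyc k n ≈ φ
    isMonic : Monic φ
open Cyclotomic

Cyclotomic-mono : ∀ {f f′ n φ} → f ≤ f′ → Cyclotomic f n φ → Cyclotomic f′ n φ
Cyclotomic-mono f≤f′ c = record { cyc≈ = λ f′≤k → cyc≈ c (ℕP.≤-trans f≤f′ f′≤k) ; isMonic = isMonic c }

prodᴾ-cyc : ∀ {f k L Φs} → f ≤ k → Pointwise (Cyclotomic f) L Φs → prodᴾ (map (cyc k) L) ≈ prodᴾ Φs
prodᴾ-cyc f≤k []       = ≈-refl
prodᴾ-cyc f≤k (c ∷ cs) = *-cong (cyc≈ c f≤k) (prodᴾ-cyc f≤k cs)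

Monic-prodᴾ : ∀ {f L Φs} → Pointwise (Cyclotomic f) L Φs → Monic (prodᴾ Φs)
Monic-prodᴾ []       = monic refl
Monic-prodᴾ (c ∷ cs) = Monic-* (isMonic c) (Monic-prodᴾ cs)

cyclotomic-step : ∀ {f n L Φs T} → 0 < n → properDivisors n ↭ L →
                  Pointwise (Cyclotomic f) L Φs → prodᴾ Φs *ᴾ T ≈ xⁿ-1 n → Cyclotomic (suc f) n T
cyclotomic-step {f} {n} {L} {Φs} {T} n>0 divisors values product = record
  { cyc≈  = λ where (s≤s f≤k) → proj₁ (exact f≤k)
  ; isMonic = proj₂ (exact ℕP.≤-refl) }
  where
  factors : ∀ {k} → f ≤ k → prodᴾ (map (cyc k) (properDivisors n)) ≈ prodᴾ Φs
  factors {k} f≤k = ≈-trans (prodᴾ-↭ (map⁺ (cyc k) divisors)) (prodᴾ-cyc f≤k values)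
  exact : ∀ {k} → f ≤ k → cyc (suc k) n ≈ T × Monic T
  exact f≤k = divᴾ-exact (Monic-xⁿ-1 n>0) (Monic-cong (≈-sym (factors f≤k)) (Monic-prodᴾ values))
                         (≈-trans (*-congʳ T (factors f≤k)) product)

cyclotomic-1 : Cyclotomic 1 1 (xⁿ-1 1)
cyclotomic-1 = cyclotomic-step (s≤s z≤n) ↭-refl [] (*-identityˡ (xⁿ-1 1))

cyclotomic-prime : ∀ {a} → Prime a → Cyclotomic 2 a (geom a)
cyclotomic-prime {a} pa = cyclotomic-step (prime⇒>0 pa) (↭-reflexive (properDivisors-prime pa)) (cyclotomic-1 ∷ [])
  (≈-trans (*-congʳ (geom a) (*-identityʳ (xⁿ-1 1))) (x-1*geom a))

-- The binary cyclotomic polynomial Φ_pq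

x-1*dilate-geom≈0 : ∀ a b {s k} → a * s ≡ 1 + b * k → xⁿ-1 1 *ᴾ dilate a (geom b) ≈ [] [mod xⁿ-1 b ]
x-1*dilate-geom≈0 a b {s} {k} as≡1+bk = begin
  xⁿ-1 1 *ᴾ Y                                ≈⟨ ≈-mod-*ʳ Y (≈-mod-sym (xⁿ-1-mod b k as≡1+bk)) ⟩
  xⁿ-1 (a * s) *ᴾ Y                          ≈⟨ ≈⇒≈-mod (*-congʳ Y (xⁿ-1*dilate-geom a s)) ⟨
  xⁿ-1 a *ᴾ dilate a (geom s) *ᴾ Y           ≈⟨ ≈⇒≈-mod (exchange (xⁿ-1 a) (dilate a (geom s)) Y) ⟩
  dilate a (geom s) *ᴾ (xⁿ-1 a *ᴾ Y)         ≈⟨ ≈⇒≈-mod (*-congˡ (dilate a (geom s)) (xⁿ-1*dilate-geom a b)) ⟩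
  dilate a (geom s) *ᴾ xⁿ-1 (a * b)          ≈⟨ ≈-mod-*ˡ (dilate a (geom s)) (∣ᴾ⇒≈0-mod b∣ab) ⟩
  dilate a (geom s) *ᴾ []                    ≈⟨ ≈⇒≈-mod (*-zeroʳ (dilate a (geom s))) ⟩
  []                                         ∎
  where
  open ≈-mod-Reasoning (xⁿ-1 b)
  Y = dilate a (geom b)
  exchange : ∀ x y z → x *ᴾ y *ᴾ z ≈ y *ᴾ (x *ᴾ z)
  exchange = Solver.solve-∀ polyRing
  b∣ab : xⁿ-1 b ∣ᴾ xⁿ-1 (a * b)
  b∣ab = subst (λ m → xⁿ-1 b ∣ᴾ xⁿ-1 m) (ℕP.*-comm b a) (xⁿ-1-∣ b a)

module Semiprime {a b : ℕ} (pa : Prime a) (pb : Prime b) (a<b : a < b) where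

  private
    inverse : Σ ℕ λ s → Σ ℕ λ k → a * s ≡ 1 + b * k
    inverse = coprime⇒inverse (Coprimality.sym (prime⇒coprime pb {{ℕ.>-nonZero (prime⇒>0 pa)}} a<b)) (prime⇒>0 pa)

    divisibility : xⁿ-1 b ∣ᴾ xⁿ-1 1 *ᴾ dilate a (geom b)
    divisibility = ≈0-mod⇒∣ᴾ (x-1*dilate-geom≈0 a b (proj₂ (proj₂ inverse)))

  Φab : Poly
  Φab = quotient divisibility

  xⁿ-1*Φab : xⁿ-1 b *ᴾ Φab ≈ xⁿ-1 1 *ᴾ dilate a (geom b)
  xⁿ-1*Φab = ≈-sym (≈-trans (equality divisibility) (*-comm Φab (xⁿ-1 b)))

  geom*Φab : geom a *ᴾ Φab ≈ dilate b (geom a)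
  geom*Φab = xⁿ-1-cancelˡ b (prime⇒>0 pb) (begin
    xⁿ-1 b *ᴾ (geom a *ᴾ Φab)                 ≈⟨ exchange (xⁿ-1 b) (geom a) Φab ⟩
    geom a *ᴾ (xⁿ-1 b *ᴾ Φab)                 ≈⟨ *-congˡ (geom a) xⁿ-1*Φab ⟩
    geom a *ᴾ (xⁿ-1 1 *ᴾ dilate a (geom b))   ≈⟨ reassociate (geom a) (xⁿ-1 1) (dilate a (geom b)) ⟩
    xⁿ-1 1 *ᴾ geom a *ᴾ dilate a (geom b)     ≈⟨ *-congʳ (dilate a (geom b)) (x-1*geom a) ⟩
    xⁿ-1 a *ᴾ dilate a (geom b)               ≈⟨ xⁿ-1*dilate-geom a b ⟩
    xⁿ-1 (a * b)                              ≈⟨ xⁿ-1-cong (ℕP.*-comm a b) ⟩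
    xⁿ-1 (b * a)                              ≈⟨ xⁿ-1*dilate-geom b a ⟨
    xⁿ-1 b *ᴾ dilate b (geom a)               ∎)
    where
    open ≈-Reasoning
    exchange : ∀ x y z → x *ᴾ (y *ᴾ z) ≈ y *ᴾ (x *ᴾ z)
    exchange = Solver.solve-∀ polyRing
    reassociate : ∀ x y z → x *ᴾ (y *ᴾ z) ≈ y *ᴾ x *ᴾ z
    reassociate = Solver.solve-∀ polyRing

  x-1*geom*geom*Φab : xⁿ-1 1 *ᴾ geom a *ᴾ geom b *ᴾ Φab ≈ xⁿ-1 (a * b)
  x-1*geom*geom*Φab = begin
    xⁿ-1 1 *ᴾ geom a *ᴾ geom b *ᴾ Φab           ≈⟨ reassociate (xⁿ-1 1) (geom a) (geom b) Φab ⟩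
    xⁿ-1 1 *ᴾ geom b *ᴾ (geom a *ᴾ Φab)         ≈⟨ *-cong (x-1*geom b) geom*Φab ⟩
    xⁿ-1 b *ᴾ dilate b (geom a)                 ≈⟨ xⁿ-1*dilate-geom b a ⟩
    xⁿ-1 (b * a)                                ≈⟨ xⁿ-1-cong (ℕP.*-comm b a) ⟩
    xⁿ-1 (a * b)                                ∎
    where
    open ≈-Reasoning
    reassociate : ∀ x y z w → x *ᴾ y *ᴾ z *ᴾ w ≈ x *ᴾ z *ᴾ (y *ᴾ w)
    reassociate = Solver.solve-∀ polyRing

  Φab*xⁿ-1*geom : Φab *ᴾ (xⁿ-1 b *ᴾ geom a) ≈ xⁿ-1 (a * b)
  Φab*xⁿ-1*geom = begin
    Φab *ᴾ (xⁿ-1 b *ᴾ geom a)                   ≈⟨ *-congˡ Φab (*-congʳ (geom a) (x-1*geom b)) ⟨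
    Φab *ᴾ (xⁿ-1 1 *ᴾ geom b *ᴾ geom a)         ≈⟨ reassociate Φab (xⁿ-1 1) (geom b) (geom a) ⟩
    xⁿ-1 1 *ᴾ geom a *ᴾ geom b *ᴾ Φab           ≈⟨ x-1*geom*geom*Φab ⟩
    xⁿ-1 (a * b)                                ∎
    where
    open ≈-Reasoning
    reassociate : ∀ φ x y z → φ *ᴾ (x *ᴾ y *ᴾ z) ≈ x *ᴾ z *ᴾ y *ᴾ φ
    reassociate = Solver.solve-∀ polyRing

  cyclotomic : Cyclotomic 3 (a * b) Φab
  cyclotomic = cyclotomic-step (ℕP.*-mono-< (prime⇒>0 pa) (prime⇒>0 pb))
    (↭-reflexive (properDivisors-semiprime pa pb a<b))
    (Cyclotomic-mono (s≤s z≤n) cyclotomic-1 ∷ cyclotomic-prime pa ∷ cyclotomic-prime pb ∷ [])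
    (≈-trans (reassociate (xⁿ-1 1) (geom a) (geom b) Φab) x-1*geom*geom*Φab)
    where
    reassociate : ∀ x y z w → x *ᴾ (y *ᴾ (z *ᴾ 1ᴾ)) *ᴾ w ≈ x *ᴾ y *ᴾ z *ᴾ w
    reassociate = Solver.solve-∀ polyRing

  length-normalForm-Φab : length (normalForm Φab) ≡ suc ((a ∸ 1) * (b ∸ 1))
  length-normalForm-Φab = cancel a b (length (normalForm Φab)) (prime⇒>0 pa) (prime⇒>0 pb) (begin
    length (normalForm Φab) + (a + b)                    ≡⟨ cong (_+_ (length (normalForm Φab))) lengthA ⟨
    length (normalForm Φab) + length (normalForm A)      ≡⟨ ℕP.+-comm (length (normalForm Φab)) _ ⟩
    length (normalForm A) + length (normalForm Φab)      ≡⟨ length-normalForm-* monicA (isMonic cyclotomic) ⟨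
    length (normalForm (A *ᴾ Φab)) + 1                   ≡⟨ cong (λ l → length l + 1) (normalForm-cong A*Φab) ⟩
    length (normalForm (xⁿ-1 (a * b))) + 1               ≡⟨ cong (_+ 1) (length-normalForm-xⁿ-1 (ℕP.*-mono-< a>0 b>0)) ⟩
    suc (a * b) + 1                                      ≡⟨ ℕP.+-comm (suc (a * b)) 1 ⟩
    suc (suc (a * b))                                    ∎)
    where
    open ≡-Reasoning
    a>0 = prime⇒>0 pa
    b>0 = prime⇒>0 pb
    A = xⁿ-1 a *ᴾ geom b
    monicA : Monic A
    monicA = Monic-* (Monic-xⁿ-1 a>0) (Monic-geom b>0)
    lengthA : length (normalForm A) ≡ a + b
    lengthA = ℕP.suc-injective (begin
      suc (length (normalForm A))                                 ≡⟨ ℕP.+-comm 1 _ ⟩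
      length (normalForm A) + 1                                   ≡⟨ length-normalForm-* (Monic-xⁿ-1 a>0) (Monic-geom b>0) ⟩
      length (normalForm (xⁿ-1 a)) + length (normalForm (geom b)) ≡⟨ cong₂ _+_ (length-normalForm-xⁿ-1 a>0) (length-normalForm-geom b>0) ⟩
      suc a + b                                                   ∎)
    A*Φab : A *ᴾ Φab ≈ xⁿ-1 (a * b)
    A*Φab = ≈-trans (*-congʳ Φab (*-congʳ (geom b) (≈-sym (x-1*geom a)))) x-1*geom*geom*Φab
    cancel : ∀ a b L → 0 < a → 0 < b → L + (a + b) ≡ suc (suc (a * b)) → L ≡ suc ((a ∸ 1) * (b ∸ 1))
    cancel (suc a′) (suc b′) L _ _ e = ℕP.+-cancelʳ-≡ (suc a′ + suc b′) L _ (trans e (expand a′ b′))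
      where
      expand : ∀ a′ b′ → suc (suc (suc a′ * suc b′)) ≡ suc (a′ * b′) + (suc a′ + suc b′)
      expand = ℕ-Solver.solve-∀

  coeff-Φab-0 : coeff Φab 0 ≡ + 1
  coeff-Φab-0 = ℤP.neg-injective (begin
    ℤ.- coeff Φab 0                                  ≡⟨ ℤP.-1*i≡-i (coeff Φab 0) ⟨
    -[1+ 0 ] ℤ.* coeff Φab 0                         ≡⟨ cong (ℤ._* coeff Φab 0) (coeff-xⁿ-1-0 (prime⇒>0 pb)) ⟨
    coeff (xⁿ-1 b) 0 ℤ.* coeff Φab 0                 ≡⟨ coeff-*ᴾ-0 (xⁿ-1 b) Φab ⟨
    coeff (xⁿ-1 b *ᴾ Φab) 0                          ≡⟨ coeff-≡ xⁿ-1*Φab 0 ⟩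
    coeff (xⁿ-1 1 *ᴾ dilate a (geom b)) 0            ≡⟨ coeff-*ᴾ-0 (xⁿ-1 1) (dilate a (geom b)) ⟩
    -[1+ 0 ] ℤ.* coeff (dilate a (geom b)) 0         ≡⟨ cong (-[1+ 0 ] ℤ.*_) (coeff-dilate-0 a (geom b) (prime⇒>0 pa)) ⟩
    -[1+ 0 ] ℤ.* coeff (geom b) 0                    ≡⟨ cong (-[1+ 0 ] ℤ.*_) (coeff-geom-0 (prime⇒>0 pb)) ⟩
    ℤ.- + 1                                          ∎)
    where
    open ≡-Reasoning

module BinaryFlatness {p q : ℕ} (pq : Prime q) (p>0 : 0 < p) (p<q : p < q) {Q : Poly}
                      (xⁿ-1*Q : xⁿ-1 q *ᴾ Q ≈ xⁿ-1 1 *ᴾ dilate p (geom q)) where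

  private
    q>0 : 0 < q
    q>0 = ℕP.<-trans p>0 p<q

  module _ (K : ℕ) where

    private
      Y : Poly
      Y = dilate q (geom K)

      F : ℕ → ℕ → ℤ
      F a = coeff (dilate p (geom a) *ᴾ Y)

      F-suc : ∀ a m → F (suc a) m ≡ coeff Y m ℤ.+ shift p (F a) m
      F-suc a m = begin
        coeff (dilate p (1ᴾ ++ geom a) *ᴾ Y) m                                   ≡⟨ coeff-≡ (expand (dilate p (geom a)) (X^ p) Y) m ⟩
        coeff (Y +ᴾ X^ p *ᴾ (dilate p (geom a) *ᴾ Y)) m                           ≡⟨ coeff-+ᴾ Y _ m ⟩
        coeff Y m ℤ.+ coeff (X^ p *ᴾ (dilate p (geom a) *ᴾ Y)) m                   ≡⟨ cong (ℤ._+_ (coeff Y m)) (coeff-X^* p _ m) ⟩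
        coeff Y m ℤ.+ shift p (F a) m                                            ∎
        where
        open ≡-Reasoning
        expand : ∀ z x y → (1ᴾ +ᴾ x *ᴾ z) *ᴾ y ≈ y +ᴾ x *ᴾ (z *ᴾ y)
        expand = Solver.solve-∀ polyRing

      Y-bits : Bits Y
      Y-bits = bits-dilate q (geom K) q>0 (bits-geom K)

      q∣ : ∀ {m} → coeff Y m ≡ + 1 → q ∣ m
      q∣ {m} Yₘ≡1 = dilate-support q (geom K) m (λ Yₘ≡0 → 1≢0 (trans (sym Yₘ≡1) Yₘ≡0))
        where
        1≢0 : ¬ + 1 ≡ + 0
        1≢0 ()

      ∸-step : ∀ m i → m ∸ p ∸ p * i ≡ m ∸ p * suc i
      ∸-step m i = trans (ℕP.∸-+-assoc m p (p * i)) (cong (m ∸_) (sym (ℕP.*-suc p i)))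

      ≤-step : ∀ {m} i → p ≤ m → p * i ≤ m ∸ p → p * suc i ≤ m
      ≤-step {m} i p≤m le = subst (_≤ m) (sym (ℕP.*-suc p i)) (subst (p + p * i ≤_) (ℕP.m+[n∸m]≡n p≤m) (ℕP.+-monoʳ-≤ p le))

      F-zero : ∀ a m → (∀ i → i < a → p * i ≤ m → coeff Y (m ∸ p * i) ≡ + 0) → F a m ≡ + 0
      F-zero zero    m _      = refl
      F-zero (suc a) m vanish = trans (F-suc a m) (cong₂ ℤ._+_ Yₘ≡0 shifted)
        where
        Yₘ≡0 : coeff Y m ≡ + 0
        Yₘ≡0 = subst (λ k → coeff Y (m ∸ k) ≡ + 0) (ℕP.*-zeroʳ p)
                     (vanish 0 (s≤s z≤n) (subst (_≤ m) (sym (ℕP.*-zeroʳ p)) z≤n))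
        shifted : shift p (F a) m ≡ + 0
        shifted with p ℕ.≤? m
        ... | no  _   = refl
        ... | yes p≤m = F-zero a (m ∸ p) λ i i<a le →
          subst (λ k → coeff Y k ≡ + 0) (sym (∸-step m i)) (vanish (suc i) (s≤s i<a) (≤-step i p≤m le))

      -- The exponents p i + q j (i < q) are distinct, because q does not divide p i for 0 < i < q.
      Y-sparse : ∀ {m} j → coeff Y m ≡ + 1 → 0 < j → j < q → p * j ≤ m → coeff Y (m ∸ p * j) ≡ + 0
      Y-sparse {m} j Yₘ≡1 j>0 j<q pj≤m with Y-bits (m ∸ p * j)
      ... | inj₁ Y≡0 = Y≡0
      ... | inj₂ Y≡1 = ⊥-elim (q∤pj (∣m+n∣m⇒∣n (subst (q ∣_) (sym (ℕP.m∸n+n≡m pj≤m)) (q∣ Yₘ≡1)) (q∣ Y≡1)))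
        where
        q∤pj : ¬ q ∣ p * j
        q∤pj q∣pj with euclidsLemma p j pq q∣pj
        ... | inj₁ q∣p = ℕP.<⇒≱ p<q (∣⇒≤ {{ℕ.>-nonZero p>0}} q∣p)
        ... | inj₂ q∣j = ℕP.<⇒≱ j<q (∣⇒≤ {{ℕ.>-nonZero j>0}} q∣j)

      F-bits : ∀ a → a ≤ q → ∀ m → Bit (F a m)
      F-bits zero    _   m = inj₁ refl
      F-bits (suc a) a<q m with Y-bits m
      ... | inj₁ Yₘ≡0 = subst Bit (sym (trans (F-suc a m) (trans (cong (ℤ._+ shift p (F a) m) Yₘ≡0) (ℤP.+-identityˡ _))))
                              (bit-shift p (F a) (F-bits a (ℕP.<⇒≤ a<q)) m)
      ... | inj₂ Yₘ≡1 = inj₂ (trans (F-suc a m) (trans (cong₂ ℤ._+_ Yₘ≡1 shifted) (ℤP.+-identityʳ (+ 1))))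
        where
        shifted : shift p (F a) m ≡ + 0
        shifted with p ℕ.≤? m
        ... | no  _   = refl
        ... | yes p≤m = F-zero a (m ∸ p) λ i i<a le → subst (λ k → coeff Y k ≡ + 0) (sym (∸-step m i))
          (Y-sparse (suc i) Yₘ≡1 (s≤s z≤n) (ℕP.≤-trans (s≤s i<a) a<q) (≤-step i p≤m le))

    A : Poly
    A = dilate p (geom q) *ᴾ Y

    x-1*A : xⁿ-1 1 *ᴾ A ≈ xⁿ-1 (q * K) *ᴾ Q
    x-1*A = xⁿ-1-cancelˡ q q>0 (begin
      xⁿ-1 q *ᴾ (xⁿ-1 1 *ᴾ (dilate p (geom q) *ᴾ Y))      ≈⟨ regroup (xⁿ-1 q) (xⁿ-1 1) (dilate p (geom q)) Y ⟩
      (xⁿ-1 1 *ᴾ dilate p (geom q)) *ᴾ (xⁿ-1 q *ᴾ Y)      ≈⟨ *-cong (≈-sym xⁿ-1*Q) (xⁿ-1*dilate-geom q K) ⟩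
      (xⁿ-1 q *ᴾ Q) *ᴾ xⁿ-1 (q * K)                       ≈⟨ rotate (xⁿ-1 q) Q (xⁿ-1 (q * K)) ⟩
      xⁿ-1 q *ᴾ (xⁿ-1 (q * K) *ᴾ Q)                       ∎)
      where
      open ≈-Reasoning
      regroup : ∀ d x e y → d *ᴾ (x *ᴾ (e *ᴾ y)) ≈ (x *ᴾ e) *ᴾ (d *ᴾ y)
      regroup = Solver.solve-∀ polyRing
      rotate : ∀ d q b → (d *ᴾ q) *ᴾ b ≈ d *ᴾ (b *ᴾ q)
      rotate = Solver.solve-∀ polyRing

    -- Below degree qK, (x^(qK) − 1) Q agrees with −Q, so there Q agrees with (1 − x) A.
    coeff≡A-difference : ∀ n → n < q * K → coeff Q n ≡ coeff A n ℤ.- shift 1 (coeff A) n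
    coeff≡A-difference n n<qK = begin
      coeff Q n                                        ≡⟨ ℤP.neg-involutive (coeff Q n) ⟨
      ℤ.- (ℤ.- coeff Q n)                              ≡⟨ cong (λ c → ℤ.- c) (trans (sym (ℤP.+-identityˡ _)) (cong (ℤ._- coeff Q n) (sym (shift-< (coeff Q) n<qK)))) ⟩
      ℤ.- (shift (q * K) (coeff Q) n ℤ.- coeff Q n)     ≡⟨ cong (λ c → ℤ.- c) (coeff-xⁿ-1* (q * K) Q n) ⟨
      ℤ.- coeff (xⁿ-1 (q * K) *ᴾ Q) n                   ≡⟨ cong (λ c → ℤ.- c) (coeff-≡ x-1*A n) ⟨
      ℤ.- coeff (xⁿ-1 1 *ᴾ A) n                         ≡⟨ cong (λ c → ℤ.- c) (coeff-xⁿ-1* 1 A n) ⟩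
      ℤ.- (shift 1 (coeff A) n ℤ.- coeff A n)           ≡⟨ negate (shift 1 (coeff A) n) (coeff A n) ⟩
      coeff A n ℤ.- shift 1 (coeff A) n                 ∎
      where
      open ≡-Reasoning
      negate : ∀ a b → ℤ.- (a ℤ.- b) ≡ b ℤ.- a
      negate = ℤ-Solver.solve-∀

    A-bits : ∀ n → Bit (coeff A n)
    A-bits = F-bits q ℕP.≤-refl

  coeff-bounded : ∀ n → ∣ coeff Q n ∣ ≤ 1
  coeff-bounded n = subst (λ c → ∣ c ∣ ≤ 1) (sym (coeff≡A-difference (suc n) n n<q*suc-n))
    (∣bit-bit∣≤1 (A-bits (suc n) n) (bit-shift 1 (coeff (A (suc n))) (A-bits (suc n)) n))
    where
    n<q*suc-n : n < q * suc n
    n<q*suc-n = ℕP.≤-trans (ℕP.n<1+n n) (ℕP.m≤n*m (suc n) q {{ℕ.>-nonZero q>0}})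

-- The ternary cyclotomic polynomial Φ_pqr and the flatness of Ψ_pqr

xⁿ-1*dilate : ∀ {p q Q} r → xⁿ-1 q *ᴾ Q ≈ xⁿ-1 1 *ᴾ dilate p (geom q) →
               xⁿ-1 (q * r) *ᴾ dilate r Q ≈ xⁿ-1 r *ᴾ dilate (p * r) (geom q)
xⁿ-1*dilate {p} {q} {Q} r xⁿ-1*Q = begin
  xⁿ-1 (q * r) *ᴾ dilate r Q                           ≈⟨ *-congʳ (dilate r Q) (≈-trans (xⁿ-1-cong (ℕP.*-comm q r)) (≈-sym (dilate-xⁿ-1 r q))) ⟩
  dilate r (xⁿ-1 q) *ᴾ dilate r Q                      ≈⟨ dilate-* r (xⁿ-1 q) Q ⟨
  dilate r (xⁿ-1 q *ᴾ Q)                               ≈⟨ dilate-cong r xⁿ-1*Q ⟩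
  dilate r (xⁿ-1 1 *ᴾ dilate p (geom q))               ≈⟨ dilate-* r (xⁿ-1 1) (dilate p (geom q)) ⟩
  dilate r (xⁿ-1 1) *ᴾ dilate r (dilate p (geom q))    ≈⟨ *-cong (≈-trans (dilate-xⁿ-1 r 1) (xⁿ-1-cong (ℕP.*-identityʳ r))) (dilate-dilate r p (geom q)) ⟩
  xⁿ-1 r *ᴾ dilate (p * r) (geom q)                    ∎
  where open ≈-Reasoning

-- Φ_pq(x) divides Φ_pq(xʳ) once r is invertible modulo p and modulo q; stated as a
-- congruence modulo x^(pq) − 1 = (x^q − 1) Φ_p(x) Φ_pq(x).
geom*xⁿ-1*dilate≈0 : ∀ p q r {t u k₁ k₂ Q} → r * t ≡ 1 + p * k₁ → r * u ≡ 1 + q * k₂ →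
                      xⁿ-1 q *ᴾ Q ≈ xⁿ-1 1 *ᴾ dilate p (geom q) →
                      geom p *ᴾ xⁿ-1 q *ᴾ dilate r Q ≈ [] [mod xⁿ-1 (p * q) ]
geom*xⁿ-1*dilate≈0 p q r {t} {u} {k₁} {k₂} {Q} rt≡1+pk₁ ru≡1+qk₂ xⁿ-1*Q = begin
  G *ᴾ xⁿ-1 q *ᴾ Qʳ                    ≈⟨ ≈-mod-*ʳ Qʳ (≈-mod-*ˡ G (≈-mod-sym qrt≡q)) ⟩
  G *ᴾ xⁿ-1 (q * r * t) *ᴾ Qʳ          ≈⟨ ≈⇒≈-mod (*-congʳ Qʳ (*-congˡ G (≈-sym (xⁿ-1*dilate-geom (q * r) t)))) ⟩
  G *ᴾ (xⁿ-1 (q * r) *ᴾ Sₜ) *ᴾ Qʳ      ≈⟨ ≈⇒≈-mod (regroup₁ G (xⁿ-1 (q * r)) Sₜ Qʳ) ⟩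
  G *ᴾ Sₜ *ᴾ (xⁿ-1 (q * r) *ᴾ Qʳ)      ≈⟨ ≈⇒≈-mod (*-congˡ (G *ᴾ Sₜ) (xⁿ-1*dilate {p} {q} {Q} r xⁿ-1*Q)) ⟩
  G *ᴾ Sₜ *ᴾ (xⁿ-1 r *ᴾ E)             ≈⟨ ≈⇒≈-mod (*-congˡ (G *ᴾ Sₜ) (*-congʳ E (≈-sym (x-1*geom r)))) ⟩
  G *ᴾ Sₜ *ᴾ (xⁿ-1 1 *ᴾ R *ᴾ E)        ≈⟨ ≈⇒≈-mod (regroup₂ G Sₜ (xⁿ-1 1) R E) ⟩
  Sₜ *ᴾ R *ᴾ E *ᴾ (xⁿ-1 1 *ᴾ G)        ≈⟨ ≈⇒≈-mod (*-congˡ (Sₜ *ᴾ R *ᴾ E) (x-1*geom p)) ⟩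
  Sₜ *ᴾ R *ᴾ E *ᴾ xⁿ-1 p               ≈⟨ ≈-mod-*ˡ (Sₜ *ᴾ R *ᴾ E) (≈-mod-sym pru≡p) ⟩
  Sₜ *ᴾ R *ᴾ E *ᴾ xⁿ-1 (p * r * u)     ≈⟨ ≈⇒≈-mod (*-congˡ (Sₜ *ᴾ R *ᴾ E) (≈-sym (xⁿ-1*dilate-geom (p * r) u))) ⟩
  Sₜ *ᴾ R *ᴾ E *ᴾ (xⁿ-1 (p * r) *ᴾ Sᵤ) ≈⟨ ≈⇒≈-mod (regroup₃ (Sₜ *ᴾ R) E (xⁿ-1 (p * r)) Sᵤ) ⟩
  Sₜ *ᴾ R *ᴾ Sᵤ *ᴾ (xⁿ-1 (p * r) *ᴾ E) ≈⟨ ≈⇒≈-mod (*-congˡ (Sₜ *ᴾ R *ᴾ Sᵤ) (xⁿ-1*dilate-geom (p * r) q)) ⟩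
  Sₜ *ᴾ R *ᴾ Sᵤ *ᴾ xⁿ-1 (p * r * q)    ≈⟨ ≈-mod-*ˡ (Sₜ *ᴾ R *ᴾ Sᵤ) (∣ᴾ⇒≈0-mod pq∣prq) ⟩
  Sₜ *ᴾ R *ᴾ Sᵤ *ᴾ []                  ≈⟨ ≈⇒≈-mod (*-zeroʳ (Sₜ *ᴾ R *ᴾ Sᵤ)) ⟩
  []                                   ∎
  where
  open ≈-mod-Reasoning (xⁿ-1 (p * q))
  G = geom p
  R = geom r
  Qʳ = dilate r Q
  Sₜ = dilate (q * r) (geom t)
  Sᵤ = dilate (p * r) (geom u)
  E = dilate (p * r) (geom q)
  regroup₁ : ∀ a b c d → a *ᴾ (b *ᴾ c) *ᴾ d ≈ a *ᴾ c *ᴾ (b *ᴾ d)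
  regroup₁ = Solver.solve-∀ polyRing
  regroup₂ : ∀ g t x ρ e → g *ᴾ t *ᴾ (x *ᴾ ρ *ᴾ e) ≈ t *ᴾ ρ *ᴾ e *ᴾ (x *ᴾ g)
  regroup₂ = Solver.solve-∀ polyRing
  regroup₃ : ∀ a e x u → a *ᴾ e *ᴾ (x *ᴾ u) ≈ a *ᴾ u *ᴾ (x *ᴾ e)
  regroup₃ = Solver.solve-∀ polyRing
  distribute : ∀ a b k → a * (1 + b * k) ≡ a + b * a * k
  distribute = ℕ-Solver.solve-∀
  qrt≡q : xⁿ-1 (q * r * t) ≈ xⁿ-1 q [mod xⁿ-1 (p * q) ]
  qrt≡q = xⁿ-1-mod (p * q) k₁ (trans (ℕP.*-assoc q r t) (trans (cong (q *_) rt≡1+pk₁) (distribute q p k₁)))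
  pru≡p : xⁿ-1 (p * r * u) ≈ xⁿ-1 p [mod xⁿ-1 (p * q) ]
  pru≡p = xⁿ-1-mod (p * q) k₂ (trans (ℕP.*-assoc p r u) (trans (cong (p *_) ru≡1+qk₂)
                                (trans (distribute p q k₂) (cong (λ m → p + m * k₂) (ℕP.*-comm q p)))))
  pq∣prq : xⁿ-1 (p * q) ∣ᴾ xⁿ-1 (p * r * q)
  pq∣prq = subst (λ m → xⁿ-1 (p * q) ∣ᴾ xⁿ-1 m) (exchange p q r) (xⁿ-1-∣ (p * q) r)
    where
    exchange : ∀ p q r → p * q * r ≡ p * r * q
    exchange = ℕ-Solver.solve-∀

module _ {p q r : ℕ} (pp : Prime p) (pq : Prime q) (pr : Prime r) (p<q : p < q) (q<r : q < r) where

  private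
    p<r : p < r
    p<r = ℕP.<-trans p<q q<r

    module PQ = Semiprime pp pq p<q
    module PR = Semiprime pp pr p<r
    module QR = Semiprime pq pr q<r

    Ψpq : Poly
    Ψpq = xⁿ-1 q *ᴾ geom p

    r-inverse : ∀ {a} → Prime a → a < r → Σ ℕ λ t → Σ ℕ λ k → r * t ≡ 1 + a * k
    r-inverse pa a<r = coprime⇒inverse (prime⇒coprime pr {{prime⇒nonZero pa}} a<r) (prime⇒>0 pr)

    divisibility : xⁿ-1 (p * q) ∣ᴾ geom p *ᴾ xⁿ-1 q *ᴾ dilate r PQ.Φab
    divisibility = ≈0-mod⇒∣ᴾ (geom*xⁿ-1*dilate≈0 p q r (proj₂ (proj₂ (r-inverse pp p<r))) (proj₂ (proj₂ (r-inverse pq q<r))) PQ.xⁿ-1*Φab)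

    Φpqr : Poly
    Φpqr = quotient divisibility

    Φpq*Φpqr : PQ.Φab *ᴾ Φpqr ≈ dilate r PQ.Φab
    Φpq*Φpqr = xⁿ-1-cancelˡ (p * q) (ℕP.*-mono-< (prime⇒>0 pp) (prime⇒>0 pq)) (begin
      xⁿ-1 (p * q) *ᴾ (Φpq *ᴾ Φpqr)                           ≈⟨ rotate (xⁿ-1 (p * q)) Φpq Φpqr ⟩
      Φpq *ᴾ (Φpqr *ᴾ xⁿ-1 (p * q))                           ≈⟨ *-congˡ Φpq (equality divisibility) ⟨
      Φpq *ᴾ (geom p *ᴾ xⁿ-1 q *ᴾ Φʳ)                         ≈⟨ *-congˡ Φpq (*-congʳ Φʳ (*-congˡ (geom p) (x-1*geom q))) ⟨
      Φpq *ᴾ (geom p *ᴾ (xⁿ-1 1 *ᴾ geom q) *ᴾ Φʳ)             ≈⟨ regroup Φpq (geom p) (xⁿ-1 1) (geom q) Φʳ ⟩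
      xⁿ-1 1 *ᴾ geom p *ᴾ geom q *ᴾ Φpq *ᴾ Φʳ                 ≈⟨ *-congʳ Φʳ PQ.x-1*geom*geom*Φab ⟩
      xⁿ-1 (p * q) *ᴾ Φʳ                                      ∎)
      where
      open ≈-Reasoning
      Φpq = PQ.Φab
      Φʳ = dilate r PQ.Φab
      rotate : ∀ d φ t → d *ᴾ (φ *ᴾ t) ≈ φ *ᴾ (t *ᴾ d)
      rotate = Solver.solve-∀ polyRing
      regroup : ∀ φ g x h e → φ *ᴾ (g *ᴾ (x *ᴾ h) *ᴾ e) ≈ x *ᴾ g *ᴾ h *ᴾ φ *ᴾ e
      regroup = Solver.solve-∀ polyRing

    Φ-proper : Poly
    Φ-proper = xⁿ-1 1 *ᴾ geom p *ᴾ geom q *ᴾ PQ.Φab *ᴾ geom r *ᴾ PR.Φab *ᴾ QR.Φab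

    Φ-proper≈ : Φ-proper ≈ PQ.Φab *ᴾ dilate r Ψpq
    Φ-proper≈ = begin
      Φ-proper                                                            ≈⟨ regroup (xⁿ-1 1) (geom p) (geom q) PQ.Φab (geom r) PR.Φab QR.Φab ⟩
      PQ.Φab *ᴾ (xⁿ-1 1 *ᴾ geom r *ᴾ (geom q *ᴾ QR.Φab) *ᴾ (geom p *ᴾ PR.Φab)) ≈⟨ *-congˡ PQ.Φab (*-cong (*-cong (x-1*geom r) QR.geom*Φab) PR.geom*Φab) ⟩
      PQ.Φab *ᴾ (xⁿ-1 r *ᴾ dilate r (geom q) *ᴾ dilate r (geom p))       ≈⟨ *-congˡ PQ.Φab (*-congʳ (dilate r (geom p)) (xⁿ-1*dilate-geom r q)) ⟩
      PQ.Φab *ᴾ (xⁿ-1 (r * q) *ᴾ dilate r (geom p))                      ≈⟨ *-congˡ PQ.Φab (*-congʳ (dilate r (geom p)) (dilate-xⁿ-1 r q)) ⟨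
      PQ.Φab *ᴾ (dilate r (xⁿ-1 q) *ᴾ dilate r (geom p))                 ≈⟨ *-congˡ PQ.Φab (dilate-* r (xⁿ-1 q) (geom p)) ⟨
      PQ.Φab *ᴾ dilate r Ψpq                                              ∎
      where
      open ≈-Reasoning
      regroup : ∀ x g h φ gʳ φ₁ φ₂ → x *ᴾ g *ᴾ h *ᴾ φ *ᴾ gʳ *ᴾ φ₁ *ᴾ φ₂ ≈ φ *ᴾ (x *ᴾ gʳ *ᴾ (h *ᴾ φ₂) *ᴾ (g *ᴾ φ₁))
      regroup = Solver.solve-∀ polyRing

    Φ-proper*Φpqr : Φ-proper *ᴾ Φpqr ≈ xⁿ-1 (p * q * r)
    Φ-proper*Φpqr = begin
      Φ-proper *ᴾ Φpqr                             ≈⟨ *-congʳ Φpqr Φ-proper≈ ⟩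
      PQ.Φab *ᴾ dilate r Ψpq *ᴾ Φpqr               ≈⟨ exchange PQ.Φab (dilate r Ψpq) Φpqr ⟩
      PQ.Φab *ᴾ Φpqr *ᴾ dilate r Ψpq               ≈⟨ *-congʳ (dilate r Ψpq) Φpq*Φpqr ⟩
      dilate r PQ.Φab *ᴾ dilate r Ψpq              ≈⟨ dilate-* r PQ.Φab Ψpq ⟨
      dilate r (PQ.Φab *ᴾ Ψpq)                     ≈⟨ dilate-cong r PQ.Φab*xⁿ-1*geom ⟩
      dilate r (xⁿ-1 (p * q))                      ≈⟨ dilate-xⁿ-1 r (p * q) ⟩
      xⁿ-1 (r * (p * q))                           ≈⟨ xⁿ-1-cong (ℕP.*-comm r (p * q)) ⟩
      xⁿ-1 (p * q * r)                             ∎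
      where
      open ≈-Reasoning
      exchange : ∀ a b c → a *ᴾ b *ᴾ c ≈ a *ᴾ c *ᴾ b
      exchange = Solver.solve-∀ polyRing

    n>0 : 0 < p * q * r
    n>0 = ℕP.*-mono-< (ℕP.*-mono-< (prime⇒>0 pp) (prime⇒>0 pq)) (prime⇒>0 pr)

    4≤n : 4 ≤ p * q * r
    4≤n = ℕP.≤-trans (ℕP.m≤m+n 4 4) (ℕP.*-mono-≤ (ℕP.*-mono-≤ (prime⇒≥2 pp) (prime⇒≥2 pq)) (prime⇒≥2 pr))

    cyclotomic-pqr : Cyclotomic 4 (p * q * r) Φpqr
    cyclotomic-pqr = cyclotomic-step n>0 (properDivisors-pqr pp pq pr p<q q<r)
      (Cyclotomic-mono (ℕP.m≤m+n 1 2) cyclotomic-1 ∷ Cyclotomic-mono (ℕP.n≤1+n 2) (cyclotomic-prime pp)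
       ∷ Cyclotomic-mono (ℕP.n≤1+n 2) (cyclotomic-prime pq) ∷ PQ.cyclotomic
       ∷ Cyclotomic-mono (ℕP.n≤1+n 2) (cyclotomic-prime pr) ∷ PR.cyclotomic ∷ QR.cyclotomic ∷ [])
      (≈-trans (*-congʳ Φpqr (flatten (xⁿ-1 1) (geom p) (geom q) PQ.Φab (geom r) PR.Φab QR.Φab)) Φ-proper*Φpqr)
      where
      flatten : ∀ a b c d e f g → a *ᴾ (b *ᴾ (c *ᴾ (d *ᴾ (e *ᴾ (f *ᴾ (g *ᴾ 1ᴾ)))))) ≈ a *ᴾ b *ᴾ c *ᴾ d *ᴾ e *ᴾ f *ᴾ g
      flatten = Solver.solve-∀ polyRing

  Ψ≈Φpq*dilate-Ψpq : Ψ (p * q * r) ≈ Semiprime.Φab pp pq p<q *ᴾ dilate r (xⁿ-1 q *ᴾ geom p)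
  Ψ≈Φpq*dilate-Ψpq = ≈-trans (proj₁ (divᴾ-exact (Monic-xⁿ-1 n>0) (Monic-cong (≈-sym Φ≈Φpqr) (isMonic cyclotomic-pqr)) Φ*Φ-proper)) Φ-proper≈
    where
    Φ≈Φpqr : Φ (p * q * r) ≈ Φpqr
    Φ≈Φpqr = cyc≈ cyclotomic-pqr 4≤n
    Φ*Φ-proper : Φ (p * q * r) *ᴾ Φ-proper ≈ xⁿ-1 (p * q * r)
    Φ*Φ-proper = ≈-trans (*-congʳ Φ-proper Φ≈Φpqr) (≈-trans (*-comm Φpqr Φ-proper) Φ-proper*Φpqr)

  Ψ-flat : (p ∸ 1) * (q ∸ 1) < r → Flat (Ψ (p * q * r))
  Ψ-flat deg<r = Flat-coeff (Ψ (p * q * r)) bounded (0 , constant)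
    where
    P : Poly
    P = reverse (normalForm PQ.Φab)
    S : Poly
    S = xⁿ-1 q *ᴾ geom p
    Ψ≈ : Ψ (p * q * r) ≈ P *ᴾ dilate r S
    Ψ≈ = ≈-trans Ψ≈Φpq*dilate-Ψpq (*-congʳ (dilate r S) (≈-sym (reverse-normalForm PQ.Φab)))
    length-P : length P ≤ r
    length-P = subst (_≤ r) (sym (trans (List.length-reverse (normalForm PQ.Φab)) PQ.length-normalForm-Φab)) deg<r
    P-bounded : ∀ i → ∣ coeff P i ∣ ≤ 1
    P-bounded i = subst (λ c → ∣ c ∣ ≤ 1) (sym (coeff-≡ (reverse-normalForm PQ.Φab) i))
                        (BinaryFlatness.coeff-bounded pq (prime⇒>0 pp) p<q PQ.xⁿ-1*Φab i)
    S-bounded : ∀ j → ∣ coeff S j ∣ ≤ 1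
    S-bounded j = subst (λ c → ∣ c ∣ ≤ 1) (sym (coeff-xⁿ-1* q (geom p) j))
                        (∣bit-bit∣≤1 (bit-shift q (coeff (geom p)) (bits-geom p) j) (bits-geom p j))
    bounded : ∀ m → ∣ coeff (Ψ (p * q * r)) m ∣ ≤ 1
    bounded m = subst (λ c → ∣ c ∣ ≤ 1) (sym (coeff-≡ Ψ≈ m))
                      (coeff-*-dilate-bounded r P S (prime⇒>0 pr) length-P P-bounded S-bounded m)
    constant : ∣ coeff (Ψ (p * q * r)) 0 ∣ ≡ 1
    constant = cong ∣_∣ (begin
      coeff (Ψ (p * q * r)) 0                    ≡⟨ coeff-≡ Ψ≈ 0 ⟩
      coeff (P *ᴾ dilate r S) 0                  ≡⟨ cong (λ k → coeff (P *ᴾ dilate r S) (k + 0)) (ℕP.*-zeroʳ r) ⟨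
      coeff (P *ᴾ dilate r S) (r * 0 + 0)        ≡⟨ coeff-*-dilate r P S length-P 0 0 (prime⇒>0 pr) ⟩
      coeff S 0 ℤ.* coeff P 0                    ≡⟨ cong₂ ℤ._*_ (coeff-*ᴾ-0 (xⁿ-1 q) (geom p)) (coeff-≡ (reverse-normalForm PQ.Φab) 0) ⟩
      coeff (xⁿ-1 q) 0 ℤ.* coeff (geom p) 0 ℤ.* coeff PQ.Φab 0
        ≡⟨ cong₂ (λ a b → a ℤ.* b ℤ.* coeff PQ.Φab 0) (coeff-xⁿ-1-0 (prime⇒>0 pq)) (coeff-geom-0 (prime⇒>0 pp)) ⟩
      -[1+ 0 ] ℤ.* + 1 ℤ.* coeff PQ.Φab 0        ≡⟨ cong (-[1+ 0 ] ℤ.* + 1 ℤ.*_) PQ.coeff-Φab-0 ⟩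
      -[1+ 0 ]                                   ∎)
      where open ≡-Reasoning

lemma9 : (p q r : ℕ) → Prime p → Prime q → Prime r
         → ¬ (2 ∣ p) → ¬ (2 ∣ q) → ¬ (2 ∣ r)
         → p < q → q < r → (p ∸ 1) * (q ∸ 1) < r
         → Flat (Ψ (p * q * r))
lemma9 p q r pp pq pr _ _ _ p<q q<r = Ψ-flat pp pq pr p<q q<r
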